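{- Let $q=p^h$ with $p$ an odd prime and $h\geq1$. In $\mathrm{PG}(3,q)$ with homogeneous coordinates $(X_0,X_1,X_2,X_3)$, let $\pi_\infty$ be the plane $X_3=0$ and let $\mathcal{C}$ be a conic in $\pi_\infty$. Let $U=\{(a_i,b_i,c_i,1): i=1,\dots,q^2-2\}$ be a set of $q^2-2$ points of $\mathrm{PG}(3,q)\setminus\pi_\infty$ such that no line joining two distinct points of $U$ meets $\pi_\infty$ in a point of $\mathcal{C}$, and assume $\sum_i a_i=\sum_i b_i=\sum_i c_i=0$ in $\mathbb{F}_q$. Write $$R(X,Y,Z,W)=\prod_{i=1}^{q^2-2}(X+a_iY+b_iZ+c_iW)=X^{q^2-2}+\sum_{i=1}^{q^2-2}\sigma_i(Y,Z,W)X^{q^2-2-i},$$ so that $\sigma_i$ is the $i$-th elementary symmetric polynomial of the multiset $\{a_iY+b_iZ+c_iW\}$. For $(y,z,w)\in\mathbb{F}_q^3\setminus\{(0,0,0)\}$ let $l(y,z,w)$ be the line $yX_0+zX_1+wX_2=0$ of $\pi_\infty$. If $l(y,z,w)$ has at least one point in common with $\mathcal{C}$, then $$R(X,y,z,w)\,\bigl(X^2-\sigma_2(y,z,w)\bigr)=(X^q-X)^q.$$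
   Context: The normalization $\sum a_i=\sum b_i=\sum c_i=0$ (equivalently $\sigma_1\equiv0$) is a standing assumption of the paper, achieved by an affine translation. -}

module Defs where

open import Level using (Level; _⊔_)
open import Data.Nat as ℕ using (ℕ; zero; suc)
open import Data.Fin using (Fin)
open import Data.List using (List; []; _∷_; map; foldr; allFin; replicate)
open import Data.Product using (_×_; Σ; ∃; _,_)
open import Relation.Nullary using (¬_)
open import Relation.Binary using (Decidable)
open import Relation.Binary.PropositionalEquality as ≡ using (_≡_)
open import Function.Bundles using (Inverse)
open import Algebra.Bundles using (CommutativeRing)

private variable c ℓ : Level

record IsField (R : CommutativeRing c ℓ) : Set (c ⊔ ℓ) where
  open CommutativeRing R
  field
    1≉0     : ¬ (1# ≈ 0#)
    inverse : ∀ x → ¬ (x ≈ 0#) → Σ Carrier λ y → x * y ≈ 1#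

HasOrder : (R : CommutativeRing c ℓ) → ℕ → Set (c ⊔ ℓ)
HasOrder R q = Inverse (CommutativeRing.setoid R) (≡.setoid (Fin q))

module _ (R : CommutativeRing c ℓ) where
  open CommutativeRing R

  ΣF : ∀ n → (Fin n → Carrier) → Carrier
  ΣF n f = foldr _+_ 0# (map f (allFin n))

  -- Univariate polynomials in X: coefficient lists, lowest degree first.
  Poly : Set c
  Poly = List Carrier

  coeff : Poly → ℕ → Carrier
  coeff []       _       = 0#
  coeff (a ∷ as) zero    = a
  coeff (a ∷ as) (suc n) = coeff as n

  _≈P_ : Poly → Poly → Set ℓ
  f ≈P g = ∀ n → coeff f n ≈ coeff g n

  _+P_ : Poly → Poly → Poly
  []       +P g        = g
  (a ∷ f)  +P []       = a ∷ f
  (a ∷ f)  +P (b ∷ g)  = (a + b) ∷ (f +P g)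

  scaleP : Carrier → Poly → Poly
  scaleP a = map (a *_)

  negP : Poly → Poly
  negP = map (-_)

  _-P_ : Poly → Poly → Poly
  f -P g = f +P negP g

  _*P_ : Poly → Poly → Poly
  []      *P g = []
  (a ∷ f) *P g = scaleP a g +P (0# ∷ (f *P g))

  constP : Carrier → Poly
  constP a = a ∷ []

  Xpow : ℕ → Poly
  Xpow n = replicate n 0# Data.List.++ (1# ∷ [])

  _^P_ : Poly → ℕ → Poly
  f ^P zero  = constP 1#
  f ^P suc n = f *P (f ^P n)

  ΠP : ∀ n → (Fin n → Poly) → Poly
  ΠP n f = foldr _*P_ (constP 1#) (map f (allFin n))

  esym : ℕ → List Carrier → Carrier
  esym zero    _        = 1#
  esym (suc k) []       = 0#
  esym (suc k) (t ∷ ts) = t * esym k ts + esym (suc k) ts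

  record Conic : Set c where
    constructor conic
    field A B C D E F : Carrier

  evalQ : Conic → Carrier → Carrier → Carrier → Carrier
  evalQ (conic A B C D E F) x y z =
    A * (x * x) + B * (y * y) + C * (z * z) + D * (x * y) + E * (x * z) + F * (y * z)

  -- non-degeneracy: the determinant of the (doubled) Gram matrix
  --   [[2A, D, E], [D, 2B, F], [E, F, 2C]]  is nonzero
  det3 : Carrier → Carrier → Carrier → Carrier → Carrier → Carrier → Carrier → Carrier → Carrier → Carrier
  det3 a b c' d e f g h i = a * (e * i - f * h) - b * (d * i - f * g) + c' * (d * h - e * g)

  NonDegenerate : Conic → Set ℓ
  NonDegenerate (conic A B C D E F) =
    ¬ (det3 (A + A) D E D (B + B) F E F (C + C) ≈ 0#)

  OnConic : Conic → Carrier → Carrier → Carrier → Set ℓ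
  OnConic Q x0 x1 x2 = ¬ (x0 ≈ 0# × x1 ≈ 0# × x2 ≈ 0#) × evalQ Q x0 x1 x2 ≈ 0#

  LineMeetsConic : Conic → Carrier → Carrier → Carrier → Set (c ⊔ ℓ)
  LineMeetsConic Q y z w =
    ∃ λ x0 → ∃ λ x1 → ∃ λ x2 →
      OnConic Q x0 x1 x2 × y * x0 + z * x1 + w * x2 ≈ 0#

module Submission where

-- Fix a point x of 𝒞 on the line l(y,z,w), and read tᵢ = aᵢy + bᵢz + cᵢw as the plane through l
-- containing the i-th point of U.  The q² affine points of such a plane fall into q lines through x,
-- and U meets each of them at most once, since x is not a direction determined by U.  So every value
-- occurs at most q times among the q² - 2 values tᵢ, and adding the two missing values d₁, d₂ yields
-- q copies of 𝔽_q.  Hence R(X)(X + d₁)(X + d₂) = ∏_{v ∈ 𝔽_q} (X + v)^q = (X^q - X)^q.  The power sums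
-- p₁ and p₂ vanish on q copies of 𝔽_q, so d₁ + d₂ = -σ₁ = 0, and since 2 is invertible the second
-- elementary symmetric function vanishes there as well, giving d₁d₂ = -σ₂.

open import Defs
open import Algebra.Bundles using (CommutativeRing; CommutativeMonoid)
open import Relation.Binary using (Setoid; Decidable)
open import Function.Bundles using (Inverse)
open import Data.Fin using (Fin)
import Relation.Binary.PropositionalEquality as ≡

-- A ring solver for an arbitrary commutative ring R with coefficients in ℤ, through the canonical
-- map ℤ → R.  Solving over R's own carrier cannot cancel x - x, since R's equality is not decidable
-- on closed terms.  The map uses the optimised multiple _×_, for which 1 × 1# is 1# itself: a
-- constant con (+ 1) then denotes 1# rather than 1# + 0#.
module IntegerSolver {c ℓ} (R : CommutativeRing c ℓ) where

  open import Data.Nat as ℕ using (ℕ; zero; suc)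
  open import Data.Integer as ℤ using (ℤ; +_; -[1+_]; _⊖_)
  import Data.Integer.Properties as ℤ
  import Data.Nat.Properties as ℕ
  open import Data.Maybe using (Maybe; just; nothing)
  open import Relation.Nullary using (yes; no)
  open import Relation.Binary.PropositionalEquality as ≡ using (_≡_)
  open import Algebra.Solver.Ring.AlmostCommutativeRing
    using (fromCommutativeRing; _-Raw-AlmostCommutative⟶_)

  open CommutativeRing R
  open import Algebra.Properties.Ring ring using (-‿distribˡ-*; -‿distribʳ-*; -‿involutive; -‿+-comm; -0#≈0#)
  open import Algebra.Properties.Semiring.Mult.TCOptimised semiring using (_×_; ×-homo-+; ×1-homo-*; 1+×)
  open import Algebra.Properties.CommutativeSemigroup +-commutativeSemigroup using (interchange)
  open import Relation.Binary.Reasoning.Setoid setoid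

  ⟦_⟧ : ℤ → Carrier
  ⟦ + n ⟧    = n × 1#
  ⟦ -[1+ n ] ⟧ = - (suc n × 1#)

  ⟦-+n⟧ : ∀ n → ⟦ ℤ.- + n ⟧ ≈ - (n × 1#)
  ⟦-+n⟧ zero    = sym -0#≈0#
  ⟦-+n⟧ (suc n) = refl

  ⟦⊖⟧ : ∀ m n → ⟦ m ⊖ n ⟧ ≈ m × 1# - n × 1#
  ⟦⊖⟧ m zero = begin
    ⟦ m ⊖ 0 ⟧      ≡⟨ ≡.cong ⟦_⟧ (ℤ.⊖-≥ {m} ℕ.z≤n) ⟩
    m × 1#         ≈⟨ +-identityʳ _ ⟨
    m × 1# + 0#    ≈⟨ +-congˡ -0#≈0# ⟨
    m × 1# - 0# ∎
  ⟦⊖⟧ zero (suc n) = begin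
    ⟦ 0 ⊖ suc n ⟧  ≡⟨ ≡.cong ⟦_⟧ (ℤ.⊖-< {0} {suc n} ℕ.z<s) ⟩
    - (suc n × 1#) ≈⟨ +-identityˡ _ ⟨
    0# - suc n × 1# ∎
  ⟦⊖⟧ (suc m) (suc n) = begin
    ⟦ suc m ⊖ suc n ⟧              ≡⟨ ≡.cong ⟦_⟧ (ℤ.[1+m]⊖[1+n]≡m⊖n m n) ⟩
    ⟦ m ⊖ n ⟧                      ≈⟨ ⟦⊖⟧ m n ⟩
    m × 1# - n × 1#                ≈⟨ +-identityˡ _ ⟨
    0# + (m × 1# - n × 1#)         ≈⟨ +-congʳ (-‿inverseʳ 1#) ⟨
    (1# - 1#) + (m × 1# - n × 1#)  ≈⟨ interchange 1# (- 1#) (m × 1#) (- (n × 1#)) ⟩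
    (1# + m × 1#) + (- 1# - n × 1#) ≈⟨ +-congˡ (-‿+-comm 1# (n × 1#)) ⟩
    (1# + m × 1#) - (1# + n × 1#)   ≈⟨ +-cong (1+× m 1#) (-‿cong (1+× n 1#)) ⟨
    suc m × 1# - suc n × 1# ∎

  +-homo : ∀ i j → ⟦ i ℤ.+ j ⟧ ≈ ⟦ i ⟧ + ⟦ j ⟧
  +-homo (+ m)      (+ n)      = ×-homo-+ 1# m n
  +-homo (+ m)      -[1+ n ]   = ⟦⊖⟧ m (suc n)
  +-homo -[1+ m ]   (+ n)      = trans (⟦⊖⟧ n (suc m)) (+-comm _ _)
  +-homo -[1+ m ]   -[1+ n ]   = begin
    - (suc (suc (m ℕ.+ n)) × 1#)       ≡⟨ ≡.cong (λ k → - (k × 1#)) (≡.sym (ℕ.+-suc (suc m) n)) ⟩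
    - ((suc m ℕ.+ suc n) × 1#)         ≈⟨ -‿cong (×-homo-+ 1# (suc m) (suc n)) ⟩
    - (suc m × 1# + suc n × 1#)        ≈⟨ -‿+-comm _ _ ⟨
    - (suc m × 1#) - suc n × 1# ∎

  -‿homo : ∀ i → ⟦ ℤ.- i ⟧ ≈ - ⟦ i ⟧
  -‿homo (+ n)    = ⟦-+n⟧ n
  -‿homo -[1+ n ] = sym (-‿involutive _)

  *-homo : ∀ i j → ⟦ i ℤ.* j ⟧ ≈ ⟦ i ⟧ * ⟦ j ⟧
  *-homo (+ m)    (+ n)    = trans (reflexive (≡.cong ⟦_⟧ (ℤ.+◃n≡+n (m ℕ.* n)))) (×1-homo-* m n)
  *-homo (+ m)    -[1+ n ] = begin
    ⟦ + m ℤ.* -[1+ n ] ⟧       ≡⟨ ≡.cong ⟦_⟧ (ℤ.-◃n≡-n (m ℕ.* suc n)) ⟩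
    ⟦ ℤ.- + (m ℕ.* suc n) ⟧    ≈⟨ ⟦-+n⟧ (m ℕ.* suc n) ⟩
    - ((m ℕ.* suc n) × 1#)     ≈⟨ -‿cong (×1-homo-* m (suc n)) ⟩
    - (m × 1# * suc n × 1#)    ≈⟨ -‿distribʳ-* _ _ ⟩
    m × 1# * - (suc n × 1#) ∎
  *-homo -[1+ m ] (+ n)    = begin
    ⟦ -[1+ m ] ℤ.* + n ⟧       ≡⟨ ≡.cong ⟦_⟧ (ℤ.-◃n≡-n (suc m ℕ.* n)) ⟩
    ⟦ ℤ.- + (suc m ℕ.* n) ⟧    ≈⟨ ⟦-+n⟧ (suc m ℕ.* n) ⟩
    - ((suc m ℕ.* n) × 1#)     ≈⟨ -‿cong (×1-homo-* (suc m) n) ⟩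
    - (suc m × 1# * n × 1#)    ≈⟨ -‿distribˡ-* _ _ ⟩
    - (suc m × 1#) * n × 1# ∎
  *-homo -[1+ m ] -[1+ n ] = begin
    (suc m ℕ.* suc n) × 1#              ≈⟨ ×1-homo-* (suc m) (suc n) ⟩
    suc m × 1# * suc n × 1#             ≈⟨ -‿involutive _ ⟨
    - - (suc m × 1# * suc n × 1#)       ≈⟨ -‿cong (-‿distribˡ-* _ _) ⟩
    - (- (suc m × 1#) * suc n × 1#)     ≈⟨ -‿distribʳ-* _ _ ⟩
    - (suc m × 1#) * - (suc n × 1#) ∎

  homomorphism : ℤ.+-*-rawRing -Raw-AlmostCommutative⟶ fromCommutativeRing R
  homomorphism = record
    { ⟦_⟧ = ⟦_⟧ ; +-homo = +-homo ; *-homo = *-homo ; -‿homo = -‿homo ; 0-homo = refl ; 1-homo = refl }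

  ⟦⟧-weaklyDecidable : ∀ i j → Maybe (⟦ i ⟧ ≈ ⟦ j ⟧)
  ⟦⟧-weaklyDecidable i j with i ℤ.≟ j
  ... | yes i≡j = just (reflexive (≡.cong ⟦_⟧ i≡j))
  ... | no _    = nothing

  open import Algebra.Solver.Ring ℤ.+-*-rawRing (fromCommutativeRing R) homomorphism ⟦⟧-weaklyDecidable public
    using (solve; _:=_; _:+_; _:*_; :-_; _:-_; con)

module MonoidFolds {a ℓ} (M : CommutativeMonoid a ℓ) where

  open import Data.Nat using (zero; suc)
  open import Data.Fin using (Fin; punchIn)
  open import Data.Fin.Properties using (punchInᵢ≢i)
  open import Data.List using (List; []; _∷_; _++_; foldr; map; tabulate)
  open import Data.List.Properties using (map-∘)
  open import Function using (_∘_)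
  open import Relation.Binary.PropositionalEquality as ≡ using (_≡_; _≢_)

  open CommutativeMonoid M
  open import Algebra.Properties.CommutativeMonoid.Sum M public
    using (sum; sum-cong-≋; sum-cong-≗; ∑-distrib-+; sum-permute; sum-replicate)
  open import Algebra.Properties.CommutativeMonoid.Sum M using (sum-remove; sum-replicate-zero)
  open import Algebra.Properties.CommutativeMonoid.Mult M public
    using (_×_; ×-congʳ; ×-homo-+)
  open import Relation.Binary.Reasoning.Setoid setoid

  foldMap : ∀ {b} {B : Set b} → (B → Carrier) → List B → Carrier
  foldMap g xs = foldr _∙_ ε (map g xs)

  module _ {b} {B : Set b} where

    foldMap-++ : ∀ (g : B → Carrier) xs ys → foldMap g (xs ++ ys) ≈ foldMap g xs ∙ foldMap g ys
    foldMap-++ g []       ys = sym (identityˡ _)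
    foldMap-++ g (x ∷ xs) ys = trans (∙-congˡ (foldMap-++ g xs ys)) (sym (assoc _ _ _))

    foldMap-map : ∀ {c} {C : Set c} (g : B → Carrier) (f : C → B) xs → foldMap g (map f xs) ≡ foldMap (g ∘ f) xs
    foldMap-map g f xs = ≡.cong (foldr _∙_ ε) (≡.sym (map-∘ xs))

    foldMap-tabulate : ∀ {n} (g : B → Carrier) (f : Fin n → B) → foldMap g (tabulate f) ≡ sum (g ∘ f)
    foldMap-tabulate {zero}  g f = ≡.refl
    foldMap-tabulate {suc n} g f = ≡.cong (g (f Fin.zero) ∙_) (foldMap-tabulate g (f ∘ Fin.suc))

  sum-δ : ∀ {n} (t : Fin n → Carrier) k → (∀ i → i ≢ k → t i ≈ ε) → sum t ≈ t k
  sum-δ {suc n} t k others = begin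
    sum t                        ≈⟨ sum-remove {n} {k} t ⟩
    t k ∙ sum (t ∘ punchIn k)    ≈⟨ ∙-congˡ (sum-cong-≋ λ j → others (punchIn k j) (punchInᵢ≢i k j)) ⟩
    t k ∙ sum {n} (λ _ → ε)      ≈⟨ ∙-congˡ (sum-replicate-zero n) ⟩
    t k ∙ ε                      ≈⟨ identityʳ _ ⟩
    t k ∎

  sum-allBut : ∀ {n} (t : Fin n → Carrier) k x → (∀ i → i ≢ k → t i ≈ x) → sum t ∙ x ≈ t k ∙ n × x
  sum-allBut {suc n} t k x others = begin
    sum t ∙ x                        ≈⟨ ∙-congʳ (sum-remove {n} {k} t) ⟩
    (t k ∙ sum (t ∘ punchIn k)) ∙ x  ≈⟨ ∙-congʳ (∙-congˡ (sum-cong-≋ λ j → others (punchIn k j) (punchInᵢ≢i k j))) ⟩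
    (t k ∙ sum {n} (λ _ → x)) ∙ x    ≈⟨ ∙-congʳ (∙-congˡ (sum-replicate n)) ⟩
    (t k ∙ n × x) ∙ x                ≈⟨ assoc _ _ _ ⟩
    t k ∙ (n × x ∙ x)                ≈⟨ ∙-congˡ (comm _ _) ⟩
    t k ∙ suc n × x ∎

  ∑-× : ∀ {n} m (f : Fin n → Carrier) → sum (λ i → m × f i) ≈ m × sum f
  ∑-× {n} zero    f = sum-replicate-zero n
  ∑-× {n} (suc m) f = begin
    sum (λ i → f i ∙ m × f i)    ≈⟨ ∑-distrib-+ f (λ i → m × f i) ⟩
    sum f ∙ sum (λ i → m × f i)  ≈⟨ ∙-congˡ (∑-× m f) ⟩
    sum f ∙ m × sum f ∎

module FiniteSetoid {s ℓs} (S : Setoid s ℓs) (_≟_ : Decidable (Setoid._≈_ S))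
  {q} (enumeration : Inverse S (≡.setoid (Fin q))) where

  open import Relation.Binary.PropositionalEquality using (_≡_; _≢_)
  import Data.Fin as Fin
  open import Data.Bool using (if_then_else_)
  open import Data.Nat as ℕ using (ℕ; zero; suc; _+_; _≤_)
  import Data.Nat.Properties as ℕ
  open import Data.List using (List; []; _∷_; _++_; length; filter; map; concatMap; replicate; allFin)
  open import Data.List.Properties using (length-++; filter-++; length-map)
  open import Data.List.Relation.Unary.All as All using (All; []; _∷_)
  import Data.List.Relation.Unary.All.Properties as All
  open import Data.List.Relation.Unary.AllPairs using (AllPairs; []; _∷_)
  import Data.List.Relation.Unary.AllPairs.Properties as AllPairs
  open import Data.Product using (_,_)
  open import Function using (_∘_)
  open import Relation.Nullary using (¬_; yes; no; does; contradiction)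
  open import Data.Fin.Permutation using (permutation)

  open Setoid S renaming (Carrier to A)
  open Inverse enumeration using (to; from; to-cong; strictlyInverseˡ; strictlyInverseʳ)

  element : Fin q → A
  element = from

  index : A → Fin q
  index = to

  element-index : ∀ x → element (index x) ≈ x
  element-index = strictlyInverseʳ

  element-injective : ∀ {i j} → element i ≈ element j → i ≡ j
  element-injective {i} {j} eq = ≡.trans (≡.sym (strictlyInverseˡ i)) (≡.trans (to-cong eq) (strictlyInverseˡ j))

  ≈element⇒index≡ : ∀ {x i} → x ≈ element i → index x ≡ i
  ≈element⇒index≡ {x} {i} x≈ei = ≡.trans (to-cong x≈ei) (strictlyInverseˡ i)

  multiplicity : A → List A → ℕ
  multiplicity v xs = length (filter (_≟ v) xs)

  multiplicity-∷ : ∀ v x xs → multiplicity v (x ∷ xs) ≡ (if does (x ≟ v) then 1 else 0) + multiplicity v xs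
  multiplicity-∷ v x xs with x ≟ v
  ... | yes _ = ≡.refl
  ... | no _  = ≡.refl

  multiplicity-++ : ∀ v xs ys → multiplicity v (xs ++ ys) ≡ multiplicity v xs + multiplicity v ys
  multiplicity-++ v xs ys = ≡.trans (≡.cong length (filter-++ (_≟ v) xs ys)) (length-++ (filter (_≟ v) xs))

  module _ {a ℓm} (M : CommutativeMonoid a ℓm) where
    private module M = CommutativeMonoid M
    open MonoidFolds M

    sum-indicator : (g : A → M.Carrier) → (∀ {x y} → x ≈ y → g x M.≈ g y) → ∀ x →
                    sum (λ i → (if does (x ≟ element i) then 1 else 0) × g (element i)) M.≈ g x
    sum-indicator g g-cong x = M.trans (sum-δ _ (index x) others) atx
      where
      others : ∀ i → i ≢ index x → (if does (x ≟ element i) then 1 else 0) × g (element i) M.≈ M.ε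
      others i i≢ with x ≟ element i
      ... | yes x≈ei = contradiction (≡.sym (≈element⇒index≡ x≈ei)) i≢
      ... | no _     = M.refl
      atx : (if does (x ≟ element (index x)) then 1 else 0) × g (element (index x)) M.≈ g x
      atx with x ≟ element (index x)
      ... | yes x≈ex = M.trans (M.identityʳ _) (g-cong (sym x≈ex))
      ... | no x≉ex  = contradiction (sym (element-index x)) x≉ex

    foldMap-byMultiplicity : (g : A → M.Carrier) → (∀ {x y} → x ≈ y → g x M.≈ g y) → ∀ xs →
                             foldMap g xs M.≈ sum (λ i → multiplicity (element i) xs × g (element i))
    foldMap-byMultiplicity g g-cong []       = M.sym (∑-× 0 (g ∘ element))
    foldMap-byMultiplicity g g-cong (x ∷ xs) = begin
      g x ∙ foldMap g xs                    ≈⟨ ∙-cong (M.sym (sum-indicator g g-cong x)) (foldMap-byMultiplicity g g-cong xs) ⟩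
      sum (λ i → δ i × gₑ i) ∙ sum (λ i → m i × gₑ i) ≈⟨ ∑-distrib-+ (λ i → δ i × gₑ i) (λ i → m i × gₑ i) ⟨
      sum (λ i → δ i × gₑ i ∙ m i × gₑ i)    ≈⟨ sum-cong-≋ (λ i → ×-homo-+ (gₑ i) (δ i) (m i)) ⟨
      sum (λ i → (δ i + m i) × gₑ i)         ≡⟨ sum-cong-≗ (λ i → ≡.cong (_× gₑ i) (≡.sym (multiplicity-∷ (element i) x xs))) ⟩
      sum (λ i → multiplicity (element i) (x ∷ xs) × gₑ i) ∎
      where
      open M using (_∙_; ∙-cong)
      open import Relation.Binary.Reasoning.Setoid M.setoid
      gₑ : Fin q → M.Carrier
      m δ : Fin q → ℕ
      gₑ i = g (element i)
      m i = multiplicity (element i) xs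
      δ i = if does (x ≟ element i) then 1 else 0

    foldMap-uniform : (g : A → M.Carrier) → (∀ {x y} → x ≈ y → g x M.≈ g y) → ∀ {k} xs →
                      (∀ i → multiplicity (element i) xs ≡ k) → foldMap g xs M.≈ k × sum (g ∘ element)
    foldMap-uniform g g-cong {k} xs uniform = M.trans (foldMap-byMultiplicity g g-cong xs)
      (M.trans (sum-cong-≋ (λ i → M.reflexive (≡.cong (_× g (element i)) (uniform i)))) (∑-× k (g ∘ element)))

    sum-bijection : (φ ψ : A → A) → (∀ {x y} → x ≈ y → φ x ≈ φ y) → (∀ {x y} → x ≈ y → ψ x ≈ ψ y) →
                    (∀ x → φ (ψ x) ≈ x) → (∀ x → ψ (φ x) ≈ x) →
                    (g : A → M.Carrier) → (∀ {x y} → x ≈ y → g x M.≈ g y) →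
                    sum (λ i → g (φ (element i))) M.≈ sum (λ i → g (element i))
    sum-bijection φ ψ φ-cong ψ-cong φψ ψφ g g-cong = M.sym (M.trans (sum-permute (g ∘ element) π)
      (sum-cong-≋ λ i → g-cong (element-index (φ (element i)))))
      where
      π = permutation (index ∘ φ ∘ element) (index ∘ ψ ∘ element)
        (λ i → ≈element⇒index≡ (trans (φ-cong (element-index _)) (φψ _)))
        (λ i → ≈element⇒index≡ (trans (ψ-cong (element-index _)) (ψφ _)))

  private module ℕ-Folds = MonoidFolds ℕ.+-0-commutativeMonoid
  open ℕ-Folds using (foldMap; foldMap-tabulate; sum-δ) renaming (sum to ∑ℕ; _×_ to _×ℕ_)

  private
    n×1≡n : ∀ n → n ×ℕ 1 ≡ n
    n×1≡n zero    = ≡.refl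
    n×1≡n (suc n) = ≡.cong suc (n×1≡n n)

    foldMap-const1 : ∀ {b} {B : Set b} (xs : List B) → foldMap (λ _ → 1) xs ≡ length xs
    foldMap-const1 []       = ≡.refl
    foldMap-const1 (x ∷ xs) = ≡.cong suc (foldMap-const1 xs)

    ∑-mono-≤ : ∀ {n} {f g : Fin n → ℕ} → (∀ i → f i ≤ g i) → ∑ℕ f ≤ ∑ℕ g
    ∑-mono-≤ {zero}  f≤g = ℕ.z≤n
    ∑-mono-≤ {suc n} f≤g = ℕ.+-mono-≤ (f≤g Fin.zero) (∑-mono-≤ (f≤g ∘ Fin.suc))

  length≡∑multiplicity : ∀ xs → length xs ≡ ∑ℕ (λ i → multiplicity (element i) xs)
  length≡∑multiplicity xs = ≡.trans (≡.sym (foldMap-const1 xs))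
    (≡.trans (foldMap-byMultiplicity ℕ.+-0-commutativeMonoid (λ _ → 1) (λ _ → ≡.refl) xs)
             (ℕ-Folds.sum-cong-≗ (λ i → n×1≡n (multiplicity (element i) xs))))

  multiplicity-none : ∀ v xs → All (λ x → ¬ x ≈ v) xs → multiplicity v xs ≡ 0
  multiplicity-none v []       []           = ≡.refl
  multiplicity-none v (x ∷ xs) (x≉v ∷ xs≉v) with x ≟ v
  ... | yes x≈v = contradiction x≈v x≉v
  ... | no _    = multiplicity-none v xs xs≉v

  multiplicity-unique : ∀ v xs → AllPairs (λ x y → ¬ x ≈ y) xs → multiplicity v xs ≤ 1
  multiplicity-unique v []       []             = ℕ.z≤n
  multiplicity-unique v (x ∷ xs) (x≉xs ∷ xs-unique) with x ≟ v
  ... | yes x≈v = ℕ.s≤s (ℕ.≤-reflexive (multiplicity-none v xs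
                    (All.map (λ x≉y y≈v → x≉y (trans x≈v (sym y≈v))) x≉xs)))
  ... | no _    = multiplicity-unique v xs xs-unique

  length≤order : ∀ xs → AllPairs (λ x y → ¬ x ≈ y) xs → length xs ≤ q
  length≤order xs xs-unique = begin
    length xs                                   ≡⟨ length≡∑multiplicity xs ⟩
    ∑ℕ (λ i → multiplicity (element i) xs)      ≤⟨ ∑-mono-≤ (λ i → multiplicity-unique (element i) xs xs-unique) ⟩
    ∑ℕ {q} (λ _ → 1)                            ≡⟨ ℕ-Folds.sum-replicate q ⟩
    q ×ℕ 1                                      ≡⟨ n×1≡n q ⟩
    q ∎
    where open ℕ.≤-Reasoning

  complement : (Fin q → ℕ) → List A
  complement d = concatMap (λ i → replicate (d i) (element i)) (allFin q)

  private
    multiplicity-concatMap : ∀ {b} {B : Set b} v (f : B → List A) xs →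
                             multiplicity v (concatMap f xs) ≡ foldMap (multiplicity v ∘ f) xs
    multiplicity-concatMap v f []       = ≡.refl
    multiplicity-concatMap v f (x ∷ xs) =
      ≡.trans (multiplicity-++ v (f x) (concatMap f xs)) (≡.cong (multiplicity v (f x) +_) (multiplicity-concatMap v f xs))

    multiplicity-replicate : ∀ v n → multiplicity v (replicate n v) ≡ n
    multiplicity-replicate v zero = ≡.refl
    multiplicity-replicate v (suc n) with v ≟ v
    ... | yes _  = ≡.cong suc (multiplicity-replicate v n)
    ... | no v≉v = contradiction refl v≉v

  multiplicity-complement : ∀ d k → multiplicity (element k) (complement d) ≡ d k
  multiplicity-complement d k = begin
    multiplicity (element k) (complement d)                      ≡⟨ multiplicity-concatMap (element k) replicates (allFin q) ⟩
    foldMap (multiplicity (element k) ∘ replicates) (allFin q)   ≡⟨ foldMap-tabulate (multiplicity (element k) ∘ replicates) (λ i → i) ⟩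
    ∑ℕ (multiplicity (element k) ∘ replicates)                   ≡⟨ sum-δ _ k others ⟩
    multiplicity (element k) (replicate (d k) (element k))       ≡⟨ multiplicity-replicate (element k) (d k) ⟩
    d k ∎
    where
    open ≡.≡-Reasoning
    replicates : Fin q → List A
    replicates i = replicate (d i) (element i)
    others : ∀ i → i ≢ k → multiplicity (element k) (replicates i) ≡ 0
    others i i≢k = multiplicity-none (element k) (replicates i)
      (All.replicate⁺ (d i) λ ei≈ek → i≢k (element-injective ei≈ek))

  module _ {b} {B : Set b} (t κ : B → A) where

    private
      multiplicity-map : ∀ v xs → multiplicity v (map t xs) ≡ length (filter (λ j → t j ≟ v) xs)
      multiplicity-map v []       = ≡.refl
      multiplicity-map v (x ∷ xs) with t x ≟ v
      ... | yes _ = ≡.cong suc (multiplicity-map v xs)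
      ... | no _  = multiplicity-map v xs

      κ-distinct-on-fiber : ∀ {v ys} → All (λ j → t j ≈ v) ys →
                            AllPairs (λ i j → t i ≈ t j → ¬ κ i ≈ κ j) ys →
                            AllPairs (λ i j → ¬ κ i ≈ κ j) ys
      κ-distinct-on-fiber []             []       = []
      κ-distinct-on-fiber (ti≈v ∷ fiber) (ri ∷ r) =
        All.zipWith (λ (tj≈v , rij) → rij (trans ti≈v (sym tj≈v))) (fiber , ri) ∷ κ-distinct-on-fiber fiber r

    multiplicity-map≤order : ∀ v xs → AllPairs (λ i j → t i ≈ t j → ¬ κ i ≈ κ j) xs →
                             multiplicity v (map t xs) ≤ q
    multiplicity-map≤order v xs t,κ-injective = begin
      multiplicity v (map t xs)  ≡⟨ multiplicity-map v xs ⟩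
      length fiber               ≡⟨ length-map κ fiber ⟨
      length (map κ fiber)       ≤⟨ length≤order (map κ fiber) (AllPairs.map⁺
                                      (κ-distinct-on-fiber (All.all-filter (λ j → t j ≟ v) xs)
                                                           (AllPairs.filter⁺ (λ j → t j ≟ v) t,κ-injective))) ⟩
      q ∎
      where
      open ℕ.≤-Reasoning
      fiber = filter (λ j → t j ≟ v) xs

module Polynomials {c ℓ} (R : CommutativeRing c ℓ) where

  open import Data.Nat as ℕ using (ℕ; zero; suc; _<_; s<s; z≤n)
  open import Data.List using (List; []; _∷_; length)
  open import Data.List.Relation.Unary.All using (All; []; _∷_)
  open import Data.List.Relation.Unary.AllPairs using (AllPairs; []; _∷_)
  open import Relation.Nullary using (¬_; contradiction)
  open import Data.Product using (Σ; _×_; _,_)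
  import Data.Integer as ℤ
  import Data.Nat.Properties as ℕ
  open import Relation.Binary.PropositionalEquality as ≡ using (_≡_; _≢_)
  open import Function using (_∘_)
  open import Algebra.Bundles using (CommutativeMonoid; Semiring)
  import Relation.Binary.Reasoning.Setoid as SetoidReasoning

  open CommutativeRing R hiding (zero)
  open import Algebra.Properties.Ring ring using (-0#≈0#; x∙y⁻¹≈ε⇒x≈y)
  open import Algebra.Definitions.RawSemiring (Semiring.rawSemiring semiring) using (_^_)
  open IntegerSolver R using (solve; _:=_; _:+_; _:*_; :-_; _:-_; con)
  open SetoidReasoning setoid

  infix  4 _≈ₚ_
  infixl 6 _+ₚ_
  infixl 7 _*ₚ_

  _+ₚ_ _*ₚ_ : Poly R → Poly R → Poly R
  _+ₚ_ = _+P_ R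
  _*ₚ_ = _*P_ R

  scale : Carrier → Poly R → Poly R
  scale = scaleP R

  1ₚ : Poly R
  1ₚ = constP R 1#

  -- Defs' _≈P_ wrapped in a record, so that both polynomials can be inferred from an equation.
  record _≈ₚ_ (f g : Poly R) : Set ℓ where
    constructor coeffwise
    field coeff≈ : ∀ n → coeff R f n ≈ coeff R g n
  open _≈ₚ_ public

  ≈ₚ-refl : ∀ {f} → f ≈ₚ f
  ≈ₚ-refl = coeffwise λ _ → refl

  ≈ₚ-sym : ∀ {f g} → f ≈ₚ g → g ≈ₚ f
  ≈ₚ-sym f≈g = coeffwise λ n → sym (coeff≈ f≈g n)

  ≈ₚ-trans : ∀ {f g h} → f ≈ₚ g → g ≈ₚ h → f ≈ₚ h
  ≈ₚ-trans f≈g g≈h = coeffwise λ n → trans (coeff≈ f≈g n) (coeff≈ g≈h n)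

  ≈ₚ-reflexive : ∀ {f g} → f ≡ g → f ≈ₚ g
  ≈ₚ-reflexive ≡.refl = ≈ₚ-refl

  coeff-+ : ∀ f g n → coeff R (f +ₚ g) n ≈ coeff R f n + coeff R g n
  coeff-+ []      g       n       = sym (+-identityˡ _)
  coeff-+ (a ∷ f) []      n       = sym (+-identityʳ _)
  coeff-+ (a ∷ f) (b ∷ g) zero    = refl
  coeff-+ (a ∷ f) (b ∷ g) (suc n) = coeff-+ f g n

  coeff-scale : ∀ a f n → coeff R (scale a f) n ≈ a * coeff R f n
  coeff-scale a []      n       = sym (zeroʳ a)
  coeff-scale a (b ∷ f) zero    = refl
  coeff-scale a (b ∷ f) (suc n) = coeff-scale a f n

  coeff-neg : ∀ f n → coeff R (negP R f) n ≈ - coeff R f n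
  coeff-neg []      n       = sym -0#≈0#
  coeff-neg (b ∷ f) zero    = refl
  coeff-neg (b ∷ f) (suc n) = coeff-neg f n

  coeff-- : ∀ f g n → coeff R (_-P_ R f g) n ≈ coeff R f n - coeff R g n
  coeff-- f g n = trans (coeff-+ f (negP R g) n) (+-congˡ (coeff-neg g n))

  coeff-X^-≢ : ∀ n m → m ≢ n → coeff R (Xpow R n) m ≡ 0#
  coeff-X^-≢ zero    zero    m≢n = contradiction ≡.refl m≢n
  coeff-X^-≢ zero    (suc m) m≢n = ≡.refl
  coeff-X^-≢ (suc n) zero    m≢n = ≡.refl
  coeff-X^-≢ (suc n) (suc m) m≢n = coeff-X^-≢ n m (m≢n ∘ ≡.cong suc)

  coeff-X^-≡ : ∀ n → coeff R (Xpow R n) n ≡ 1#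
  coeff-X^-≡ zero    = ≡.refl
  coeff-X^-≡ (suc n) = coeff-X^-≡ n

  coeff-*-∷ : ∀ a f g n → coeff R ((a ∷ f) *ₚ g) n ≈ a * coeff R g n + coeff R (0# ∷ (f *ₚ g)) n
  coeff-*-∷ a f g n = trans (coeff-+ (scale a g) (0# ∷ (f *ₚ g)) n) (+-congʳ (coeff-scale a g n))

  +ₚ-cong : ∀ {f f′ g g′} → f ≈ₚ f′ → g ≈ₚ g′ → f +ₚ g ≈ₚ f′ +ₚ g′
  +ₚ-cong {f} {f′} {g} {g′} f≈f′ g≈g′ = coeffwise λ n →
    trans (coeff-+ f g n) (trans (+-cong (coeff≈ f≈f′ n) (coeff≈ g≈g′ n)) (sym (coeff-+ f′ g′ n)))

  scale-cong : ∀ {a b f g} → a ≈ b → f ≈ₚ g → scale a f ≈ₚ scale b g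
  scale-cong {a} {b} {f} {g} a≈b f≈g = coeffwise λ n →
    trans (coeff-scale a f n) (trans (*-cong a≈b (coeff≈ f≈g n)) (sym (coeff-scale b g n)))

  ∷-cong : ∀ {a b f g} → a ≈ b → f ≈ₚ g → (a ∷ f) ≈ₚ (b ∷ g)
  ∷-cong a≈b f≈g = coeffwise λ where
    zero    → a≈b
    (suc n) → coeff≈ f≈g n

  ≈[]-head : ∀ {a f} → (a ∷ f) ≈ₚ [] → a ≈ 0#
  ≈[]-head a∷f≈[] = coeff≈ a∷f≈[] zero

  ≈[]-tail : ∀ {a f} → (a ∷ f) ≈ₚ [] → f ≈ₚ []
  ≈[]-tail a∷f≈[] = coeffwise λ n → coeff≈ a∷f≈[] (suc n)

  0∷[]≈[] : (0# ∷ []) ≈ₚ []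
  0∷[]≈[] = coeffwise λ where
    zero    → refl
    (suc n) → refl

  ≈[]⇒*ₚ≈[] : ∀ f g → f ≈ₚ [] → f *ₚ g ≈ₚ []
  ≈[]⇒*ₚ≈[] []      g f≈[] = ≈ₚ-refl
  ≈[]⇒*ₚ≈[] (a ∷ f) g a∷f≈[] = coeffwise λ n → trans (coeff-*-∷ a f g n) (go n)
    where
    a≈0 = ≈[]-head a∷f≈[]
    go : ∀ n → a * coeff R g n + coeff R (0# ∷ (f *ₚ g)) n ≈ 0#
    go zero    = trans (+-congʳ (trans (*-congʳ a≈0) (zeroˡ _))) (+-identityˡ _)
    go (suc n) = trans (+-cong (trans (*-congʳ a≈0) (zeroˡ _)) (coeff≈ (≈[]⇒*ₚ≈[] f g (≈[]-tail a∷f≈[])) n))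
                       (+-identityˡ _)

  *ₚ-congˡ : ∀ {f f′} g → f ≈ₚ f′ → f *ₚ g ≈ₚ f′ *ₚ g
  *ₚ-congˡ {[]}    {[]}      g f≈f′ = ≈ₚ-refl
  *ₚ-congˡ {[]}    {a ∷ f′}  g f≈f′ = ≈ₚ-sym (≈[]⇒*ₚ≈[] (a ∷ f′) g (≈ₚ-sym f≈f′))
  *ₚ-congˡ {a ∷ f} {[]}      g f≈f′ = ≈[]⇒*ₚ≈[] (a ∷ f) g f≈f′
  *ₚ-congˡ {a ∷ f} {a′ ∷ f′} g f≈f′ =
    +ₚ-cong (scale-cong (coeff≈ f≈f′ zero) ≈ₚ-refl)
            (∷-cong refl (*ₚ-congˡ {f} {f′} g (coeffwise λ n → coeff≈ f≈f′ (suc n))))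

  *ₚ-congʳ : ∀ f {g g′} → g ≈ₚ g′ → f *ₚ g ≈ₚ f *ₚ g′
  *ₚ-congʳ []      g≈g′ = ≈ₚ-refl
  *ₚ-congʳ (a ∷ f) g≈g′ = +ₚ-cong (scale-cong refl g≈g′) (∷-cong refl (*ₚ-congʳ f g≈g′))

  *ₚ-cong : ∀ {f f′ g g′} → f ≈ₚ f′ → g ≈ₚ g′ → f *ₚ g ≈ₚ f′ *ₚ g′
  *ₚ-cong {f} {f′} {g} f≈f′ g≈g′ = ≈ₚ-trans (*ₚ-congˡ g f≈f′) (*ₚ-congʳ f′ g≈g′)

  +ₚ-identityʳ : ∀ f → f +ₚ [] ≈ₚ f
  +ₚ-identityʳ []      = ≈ₚ-refl
  +ₚ-identityʳ (a ∷ f) = ≈ₚ-refl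

  +ₚ-comm : ∀ f g → f +ₚ g ≈ₚ g +ₚ f
  +ₚ-comm f g = coeffwise λ n → trans (coeff-+ f g n) (trans (+-comm _ _) (sym (coeff-+ g f n)))

  +ₚ-assoc : ∀ f g h → (f +ₚ g) +ₚ h ≈ₚ f +ₚ (g +ₚ h)
  +ₚ-assoc f g h = coeffwise λ n → begin
    coeff R ((f +ₚ g) +ₚ h) n                  ≈⟨ trans (coeff-+ (f +ₚ g) h n) (+-congʳ (coeff-+ f g n)) ⟩
    coeff R f n + coeff R g n + coeff R h n    ≈⟨ +-assoc _ _ _ ⟩
    coeff R f n + (coeff R g n + coeff R h n)  ≈⟨ trans (coeff-+ f (g +ₚ h) n) (+-congˡ (coeff-+ g h n)) ⟨
    coeff R (f +ₚ (g +ₚ h)) n                  ∎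

  +ₚ-swap : ∀ f g h → f +ₚ (g +ₚ h) ≈ₚ g +ₚ (f +ₚ h)
  +ₚ-swap f g h = ≈ₚ-trans (≈ₚ-sym (+ₚ-assoc f g h))
    (≈ₚ-trans (+ₚ-cong (+ₚ-comm f g) (≈ₚ-refl {h})) (+ₚ-assoc g f h))

  *ₚ-distribʳ : ∀ h f g → (f +ₚ g) *ₚ h ≈ₚ f *ₚ h +ₚ g *ₚ h
  *ₚ-distribʳ h []      g       = ≈ₚ-refl
  *ₚ-distribʳ h (a ∷ f) []      = ≈ₚ-sym (+ₚ-identityʳ _)
  *ₚ-distribʳ h (a ∷ f) (b ∷ g) = coeffwise λ n → begin
    coeff R (((a + b) ∷ (f +ₚ g)) *ₚ h) n
      ≈⟨ coeff-*-∷ (a + b) (f +ₚ g) h n ⟩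
    (a + b) * coeff R h n + coeff R (0# ∷ ((f +ₚ g) *ₚ h)) n
      ≈⟨ +-congˡ (coeff≈ (∷-cong refl (*ₚ-distribʳ h f g)) n) ⟩
    (a + b) * coeff R h n + coeff R (0# ∷ (f *ₚ h +ₚ g *ₚ h)) n
      ≈⟨ shifted n ⟩
    (a * coeff R h n + coeff R (0# ∷ (f *ₚ h)) n) + (b * coeff R h n + coeff R (0# ∷ (g *ₚ h)) n)
      ≈⟨ +-cong (coeff-*-∷ a f h n) (coeff-*-∷ b g h n) ⟨
    coeff R ((a ∷ f) *ₚ h) n + coeff R ((b ∷ g) *ₚ h) n
      ≈⟨ coeff-+ ((a ∷ f) *ₚ h) ((b ∷ g) *ₚ h) n ⟨
    coeff R ((a ∷ f) *ₚ h +ₚ (b ∷ g) *ₚ h) n ∎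
    where
    shifted : ∀ n → (a + b) * coeff R h n + coeff R (0# ∷ (f *ₚ h +ₚ g *ₚ h)) n ≈
                    (a * coeff R h n + coeff R (0# ∷ (f *ₚ h)) n) + (b * coeff R h n + coeff R (0# ∷ (g *ₚ h)) n)
    shifted zero    = solve 3 (λ a b x → ((a :+ b) :* x :+ con (ℤ.+ 0)) := ((a :* x :+ con (ℤ.+ 0)) :+ (b :* x :+ con (ℤ.+ 0))))
                        refl a b (coeff R h 0)
    shifted (suc n) = trans (+-congˡ (coeff-+ (f *ₚ h) (g *ₚ h) n))
      (solve 5 (λ a b x u v → ((a :+ b) :* x :+ (u :+ v)) := ((a :* x :+ u) :+ (b :* x :+ v)))
         refl a b (coeff R h (suc n)) (coeff R (f *ₚ h) n) (coeff R (g *ₚ h) n))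

  *ₚ-zeroʳ : ∀ g → g *ₚ [] ≈ₚ []
  *ₚ-zeroʳ []      = ≈ₚ-refl
  *ₚ-zeroʳ (b ∷ g) = ≈ₚ-trans (∷-cong refl (*ₚ-zeroʳ g)) 0∷[]≈[]

  *ₚ-∷ʳ : ∀ a f g → g *ₚ (a ∷ f) ≈ₚ scale a g +ₚ (0# ∷ (g *ₚ f))
  *ₚ-∷ʳ a f []      = ≈ₚ-sym 0∷[]≈[]
  *ₚ-∷ʳ a f (b ∷ g) = ∷-cong (+-congʳ (*-comm b a))
    (≈ₚ-trans (+ₚ-cong (≈ₚ-refl {scale b f}) (*ₚ-∷ʳ a f g)) (+ₚ-swap (scale b f) (scale a g) (0# ∷ (g *ₚ f))))

  *ₚ-comm : ∀ f g → f *ₚ g ≈ₚ g *ₚ f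
  *ₚ-comm []      g = ≈ₚ-sym (*ₚ-zeroʳ g)
  *ₚ-comm (a ∷ f) g = ≈ₚ-trans (+ₚ-cong (≈ₚ-refl {scale a g}) (∷-cong refl (*ₚ-comm f g))) (≈ₚ-sym (*ₚ-∷ʳ a f g))

  scale-+ : ∀ a f g → scale a (f +ₚ g) ≈ₚ scale a f +ₚ scale a g
  scale-+ a f g = coeffwise λ n → begin
    coeff R (scale a (f +ₚ g)) n         ≈⟨ trans (coeff-scale a (f +ₚ g) n) (*-congˡ (coeff-+ f g n)) ⟩
    a * (coeff R f n + coeff R g n)      ≈⟨ distribˡ _ _ _ ⟩
    a * coeff R f n + a * coeff R g n    ≈⟨ trans (coeff-+ (scale a f) (scale a g) n) (+-cong (coeff-scale a f n) (coeff-scale a g n)) ⟨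
    coeff R (scale a f +ₚ scale a g) n   ∎

  scale-scale : ∀ a b f → scale a (scale b f) ≈ₚ scale (a * b) f
  scale-scale a b f = coeffwise λ n → begin
    coeff R (scale a (scale b f)) n   ≈⟨ trans (coeff-scale a (scale b f) n) (*-congˡ (coeff-scale b f n)) ⟩
    a * (b * coeff R f n)             ≈⟨ *-assoc _ _ _ ⟨
    a * b * coeff R f n               ≈⟨ coeff-scale (a * b) f n ⟨
    coeff R (scale (a * b) f) n       ∎

  scale-*ₚ : ∀ a g h → scale a g *ₚ h ≈ₚ scale a (g *ₚ h)
  scale-*ₚ a []      h = ≈ₚ-refl
  scale-*ₚ a (b ∷ g) h = ≈ₚ-trans
    (+ₚ-cong (≈ₚ-sym (scale-scale a b h)) (∷-cong (sym (zeroʳ a)) (scale-*ₚ a g h)))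
    (≈ₚ-sym (scale-+ a (scale b h) (0# ∷ (g *ₚ h))))

  0∷-*ₚ : ∀ f h → (0# ∷ f) *ₚ h ≈ₚ (0# ∷ (f *ₚ h))
  0∷-*ₚ f h = +ₚ-cong {scale 0# h} {[]} (coeffwise λ n → trans (coeff-scale 0# h n) (zeroˡ _)) (≈ₚ-refl {0# ∷ (f *ₚ h)})

  *ₚ-assoc : ∀ f g h → (f *ₚ g) *ₚ h ≈ₚ f *ₚ (g *ₚ h)
  *ₚ-assoc []      g h = ≈ₚ-refl
  *ₚ-assoc (a ∷ f) g h = ≈ₚ-trans (*ₚ-distribʳ h (scale a g) (0# ∷ (f *ₚ g)))
    (+ₚ-cong (scale-*ₚ a g h) (≈ₚ-trans (0∷-*ₚ (f *ₚ g) h) (∷-cong refl (*ₚ-assoc f g h))))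

  *ₚ-identityˡ : ∀ f → 1ₚ *ₚ f ≈ₚ f
  *ₚ-identityˡ f = coeffwise λ n → begin
    coeff R (scale 1# f +ₚ (0# ∷ [])) n         ≈⟨ coeff-+ (scale 1# f) (0# ∷ []) n ⟩
    coeff R (scale 1# f) n + coeff R (0# ∷ []) n ≈⟨ +-cong (coeff-scale 1# f n) (coeff≈ 0∷[]≈[] n) ⟩
    1# * coeff R f n + 0#                        ≈⟨ +-identityʳ _ ⟩
    1# * coeff R f n                             ≈⟨ *-identityˡ _ ⟩
    coeff R f n                                  ∎

  *ₚ-commutativeMonoid : CommutativeMonoid c ℓ
  *ₚ-commutativeMonoid = record
    { Carrier = Poly R ; _≈_ = _≈ₚ_ ; _∙_ = _*ₚ_ ; ε = 1ₚ
    ; isCommutativeMonoid = record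
      { isMonoid = record
        { isSemigroup = record
          { isMagma = record
            { isEquivalence = record { refl = ≈ₚ-refl ; sym = ≈ₚ-sym ; trans = ≈ₚ-trans }
            ; ∙-cong = *ₚ-cong }
          ; assoc = *ₚ-assoc }
        ; identity = *ₚ-identityˡ , λ f → ≈ₚ-trans (*ₚ-comm f 1ₚ) (*ₚ-identityˡ f) }
      ; comm = *ₚ-comm } }

  module ≈ₚ-Reasoning = SetoidReasoning (CommutativeMonoid.setoid *ₚ-commutativeMonoid)

  open MonoidFolds *ₚ-commutativeMonoid public using () renaming (foldMap to ∏ₚ)

  infix 9 X+_
  X+_ : Carrier → Poly R
  X+ a = a ∷ 1# ∷ []

  X+-cong : ∀ {a b} → a ≈ b → X+ a ≈ₚ X+ b
  X+-cong a≈b = ∷-cong a≈b ≈ₚ-refl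

  X+-*ₚ : ∀ a f → X+ a *ₚ f ≈ₚ scale a f +ₚ (0# ∷ f)
  X+-*ₚ a f = +ₚ-cong (≈ₚ-refl {scale a f}) (∷-cong refl (*ₚ-identityˡ f))

  eval : Poly R → Carrier → Carrier
  eval []      x = 0#
  eval (a ∷ f) x = a + x * eval f x

  ≈[]⇒eval≈0 : ∀ f x → f ≈ₚ [] → eval f x ≈ 0#
  ≈[]⇒eval≈0 []      x f≈[] = refl
  ≈[]⇒eval≈0 (a ∷ f) x a∷f≈[] = trans
    (+-cong (≈[]-head a∷f≈[]) (trans (*-congˡ (≈[]⇒eval≈0 f x (≈[]-tail a∷f≈[]))) (zeroʳ x)))
    (+-identityˡ 0#)

  eval-cong : ∀ {f g} x → f ≈ₚ g → eval f x ≈ eval g x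
  eval-cong {[]}    {[]}    x f≈g = refl
  eval-cong {[]}    {b ∷ g} x f≈g = sym (≈[]⇒eval≈0 (b ∷ g) x (≈ₚ-sym f≈g))
  eval-cong {a ∷ f} {[]}    x f≈g = ≈[]⇒eval≈0 (a ∷ f) x f≈g
  eval-cong {a ∷ f} {b ∷ g} x f≈g =
    +-cong (coeff≈ f≈g zero) (*-congˡ (eval-cong {f} {g} x (coeffwise λ n → coeff≈ f≈g (suc n))))

  eval-+ : ∀ f g x → eval (f +ₚ g) x ≈ eval f x + eval g x
  eval-+ []      g       x = sym (+-identityˡ _)
  eval-+ (a ∷ f) []      x = sym (+-identityʳ _)
  eval-+ (a ∷ f) (b ∷ g) x = trans (+-congˡ (*-congˡ (eval-+ f g x)))
    (solve 5 (λ a b x u v → (a :+ b :+ x :* (u :+ v)) := ((a :+ x :* u) :+ (b :+ x :* v)))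
       refl a b x (eval f x) (eval g x))

  eval-scale : ∀ a f x → eval (scale a f) x ≈ a * eval f x
  eval-scale a []      x = sym (zeroʳ a)
  eval-scale a (b ∷ f) x = trans (+-congˡ (*-congˡ (eval-scale a f x)))
    (solve 4 (λ a b x u → (a :* b :+ x :* (a :* u)) := (a :* (b :+ x :* u))) refl a b x (eval f x))

  eval-* : ∀ f g x → eval (f *ₚ g) x ≈ eval f x * eval g x
  eval-* []      g x = sym (zeroˡ _)
  eval-* (a ∷ f) g x = begin
    eval (scale a g +ₚ (0# ∷ (f *ₚ g))) x           ≈⟨ eval-+ (scale a g) (0# ∷ (f *ₚ g)) x ⟩
    eval (scale a g) x + (0# + x * eval (f *ₚ g) x) ≈⟨ +-cong (eval-scale a g x) (trans (+-identityˡ _) (*-congˡ (eval-* f g x))) ⟩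
    a * eval g x + x * (eval f x * eval g x)        ≈⟨ solve 4 (λ a x u v → (a :* v :+ x :* (u :* v)) := ((a :+ x :* u) :* v))
                                                         refl a x (eval f x) (eval g x) ⟩
    (a + x * eval f x) * eval g x                   ∎

  eval-neg : ∀ f x → eval (negP R f) x ≈ - eval f x
  eval-neg []      x = sym -0#≈0#
  eval-neg (a ∷ f) x = trans (+-congˡ (*-congˡ (eval-neg f x)))
    (solve 3 (λ a x u → ((:- a) :+ x :* (:- u)) := (:- (a :+ x :* u))) refl a x (eval f x))

  eval-- : ∀ f g x → eval (_-P_ R f g) x ≈ eval f x - eval g x
  eval-- f g x = trans (eval-+ f (negP R g) x) (+-congˡ (eval-neg g x))

  eval-X^ : ∀ n x → eval (Xpow R n) x ≈ x ^ n
  eval-X^ zero    x = trans (+-congˡ (zeroʳ x)) (+-identityʳ 1#)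
  eval-X^ (suc n) x = trans (+-identityˡ _) (*-congˡ (eval-X^ n x))

  eval-X+ : ∀ a x → eval (X+ a) x ≈ a + x
  eval-X+ a x = +-congˡ (trans (*-congˡ (trans (+-congˡ (zeroʳ x)) (+-identityʳ 1#))) (*-identityʳ x))

  ∏ₚ-X+-pair : ∀ d₁ d₂ → ∏ₚ X+_ (d₁ ∷ d₂ ∷ []) ≈ₚ (d₁ * d₂) ∷ (d₁ + d₂) ∷ 1# ∷ []
  ∏ₚ-X+-pair d₁ d₂ = coeffwise coeffs
    where
    𝟙 = con (ℤ.+ 1)
    𝟘 = con (ℤ.+ 0)
    coeffs : ∀ n → coeff R (∏ₚ X+_ (d₁ ∷ d₂ ∷ [])) n ≈ coeff R ((d₁ * d₂) ∷ (d₁ + d₂) ∷ 1# ∷ []) n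
    coeffs 0 = solve 2 (λ d₁ d₂ → d₁ :* (d₂ :* 𝟙 :+ 𝟘) :+ 𝟘 := d₁ :* d₂) refl d₁ d₂
    coeffs 1 = solve 2 (λ d₁ d₂ → d₁ :* (𝟙 :* 𝟙 :+ 𝟘) :+ (𝟙 :* (d₂ :* 𝟙 :+ 𝟘) :+ 𝟘) := d₁ :+ d₂) refl d₁ d₂
    coeffs 2 = trans (*-identityˡ _) (trans (+-identityʳ _) (*-identityˡ 1#))
    coeffs (suc (suc (suc n))) = refl

  -- Synthetic division by X - a: the quotient's coefficients are the values at a of the tails of f.
  quotient : Carrier → Poly R → Poly R
  quotient a []      = []
  quotient a (b ∷ f) = eval f a ∷ quotient a f

  quotient-remainder : ∀ a f → f ≈ₚ scale (- a) (quotient a f) +ₚ (eval f a ∷ quotient a f)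
  quotient-remainder a []      = ≈ₚ-sym 0∷[]≈[]
  quotient-remainder a (b ∷ f) = ∷-cong
    (solve 3 (λ a b r → b := ((:- a) :* r :+ (b :+ a :* r))) refl a b (eval f a))
    (quotient-remainder a f)

  factor-theorem : ∀ a f → eval f a ≈ 0# → f ≈ₚ X+ (- a) *ₚ quotient a f
  factor-theorem a f fa≈0 = ≈ₚ-trans (quotient-remainder a f)
    (≈ₚ-trans (+ₚ-cong (≈ₚ-refl {scale (- a) (quotient a f)}) (∷-cong fa≈0 ≈ₚ-refl))
              (≈ₚ-sym (X+-*ₚ (- a) (quotient a f))))

  Degree≤ : Poly R → ℕ → Set ℓ
  Degree≤ f n = ∀ m → n < m → coeff R f m ≈ 0#

  private
    eval-constant : ∀ f x → Degree≤ f 0 → eval f x ≈ coeff R f 0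
    eval-constant []      x deg0 = refl
    eval-constant (b ∷ f) x deg0 = trans
      (+-congˡ (trans (*-congˡ (≈[]⇒eval≈0 f x (coeffwise λ m → deg0 (suc m) (s<s z≤n)))) (zeroʳ x)))
      (+-identityʳ b)

    quotient-constant : ∀ a f → Degree≤ f 0 → quotient a f ≈ₚ []
    quotient-constant a []      deg0 = ≈ₚ-refl
    quotient-constant a (b ∷ f) deg0 = coeffwise λ where
        zero    → ≈[]⇒eval≈0 f a f≈[]
        (suc m) → coeff≈ (quotient-constant a f (λ m _ → coeff≈ f≈[] m)) m
      where
      f≈[] : f ≈ₚ []
      f≈[] = coeffwise λ m → deg0 (suc m) (s<s z≤n)

  quotient-degree : ∀ a f n → Degree≤ f (suc n) →
                    Degree≤ (quotient a f) n × coeff R (quotient a f) n ≈ coeff R f (suc n)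
  quotient-degree a []      n       deg = (λ _ _ → refl) , refl
  quotient-degree a (b ∷ f) zero    deg =
    (λ { (suc m) _ → coeff≈ (quotient-constant a f (λ m 0<m → deg (suc m) (s<s 0<m))) m }) , eval-constant f a (λ m 0<m → deg (suc m) (s<s 0<m))
  quotient-degree a (b ∷ f) (suc n) deg with quotient-degree a f n (λ m n<m → deg (suc m) (s<s n<m))
  ... | deg′ , lc′ = (λ { (suc m) (s<s n<m) → deg′ m n<m }) , lc′

  module _ (cancel : ∀ {a b} → ¬ a ≈ 0# → a * b ≈ 0# → b ≈ 0#) where

    private
      X-roots : List Carrier → Poly R
      X-roots = ∏ₚ (λ a → X+ (- a))

      quotient-roots : ∀ a f xs → f ≈ₚ X+ (- a) *ₚ quotient a f → All (λ b → ¬ a ≈ b) xs →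
                       All (λ b → eval f b ≈ 0#) xs → All (λ b → eval (quotient a f) b ≈ 0#) xs
      quotient-roots a f []       f≈ []           []           = []
      quotient-roots a f (b ∷ xs) f≈ (a≉b ∷ a≉xs) (fb≈0 ∷ fxs≈0) =
        cancel (λ -a+b≈0 → a≉b (sym (x∙y⁻¹≈ε⇒x≈y b a (trans (+-comm b (- a)) -a+b≈0)))) (begin
          (- a + b) * eval (quotient a f) b               ≈⟨ *-congʳ (eval-X+ (- a) b) ⟨
          eval (X+ (- a)) b * eval (quotient a f) b       ≈⟨ eval-* (X+ (- a)) (quotient a f) b ⟨
          eval (X+ (- a) *ₚ quotient a f) b               ≈⟨ eval-cong b f≈ ⟨
          eval f b                                        ≈⟨ fb≈0 ⟩
          0# ∎) ∷ quotient-roots a f xs f≈ a≉xs fxs≈0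

      roots-factor : ∀ xs f n → Degree≤ f (length xs ℕ.+ n) →
                     All (λ a → eval f a ≈ 0#) xs → AllPairs (λ a b → ¬ a ≈ b) xs →
                     Σ (Poly R) λ g → Degree≤ g n × coeff R g n ≈ coeff R f (length xs ℕ.+ n) × f ≈ₚ X-roots xs *ₚ g
      roots-factor []       f n deg []             []              = f , deg , refl , ≈ₚ-sym (*ₚ-identityˡ f)
      roots-factor (a ∷ xs) f n deg (fa≈0 ∷ fxs≈0) (a≉xs ∷ unique) =
        let deg-q , lc-q          = quotient-degree a f (length xs ℕ.+ n) deg
            g , deg-g , lc-g , q≈ = roots-factor xs (quotient a f) n deg-q (quotient-roots a f xs f≈ a≉xs fxs≈0) unique
        in g , deg-g , trans lc-g lc-q ,
           ≈ₚ-trans f≈ (≈ₚ-trans (*ₚ-congʳ (X+ (- a)) q≈) (≈ₚ-sym (*ₚ-assoc (X+ (- a)) (X-roots xs) g)))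
        where f≈ = factor-theorem a f fa≈0

    monic-roots-factor : ∀ xs f → Degree≤ f (length xs) → coeff R f (length xs) ≈ 1# →
                         All (λ a → eval f a ≈ 0#) xs → AllPairs (λ a b → ¬ a ≈ b) xs →
                         f ≈ₚ ∏ₚ (λ a → X+ (- a)) xs
    monic-roots-factor xs f deg monic roots unique
      with roots-factor xs f 0 (≡.subst (Degree≤ f) (≡.sym (ℕ.+-identityʳ _)) deg) roots unique
    ... | g , deg-g , lc-g , f≈ = ≈ₚ-trans f≈ (≈ₚ-trans (*ₚ-congʳ (X-roots xs) g≈1) (≈ₚ-trans (*ₚ-comm _ 1ₚ) (*ₚ-identityˡ _)))
      where
      g≈1 : g ≈ₚ 1ₚ
      g≈1 = coeffwise λ where
        zero    → trans lc-g (trans (reflexive (≡.cong (coeff R f) (ℕ.+-identityʳ _))) monic)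
        (suc m) → deg-g (suc m) (s<s z≤n)

module SymmetricFunctions {c ℓ} (R : CommutativeRing c ℓ) where

  open import Data.List using (List; []; _∷_; _++_)
  import Data.Integer as ℤ

  open CommutativeRing R
  open MonoidFolds +-commutativeMonoid using (foldMap; foldMap-++)
  open IntegerSolver R using (solve; _:=_; _:+_; _:*_; _:-_; con)
  open import Relation.Binary.Reasoning.Setoid setoid

  p₁ p₂ : List Carrier → Carrier
  p₁ = foldMap (λ x → x)
  p₂ = foldMap (λ x → x * x)

  e₁≈p₁ : ∀ xs → esym R 1 xs ≈ p₁ xs
  e₁≈p₁ []       = refl
  e₁≈p₁ (x ∷ xs) = +-cong (*-identityʳ x) (e₁≈p₁ xs)

  e₂-++ : ∀ xs ys → esym R 2 (xs ++ ys) ≈ esym R 2 xs + p₁ xs * p₁ ys + esym R 2 ys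
  e₂-++ [] ys = solve 2 (λ u v → v := (con (ℤ.+ 0) :+ con (ℤ.+ 0) :* u :+ v)) refl (p₁ ys) (esym R 2 ys)
  e₂-++ (x ∷ xs) ys = begin
    x * esym R 1 (xs ++ ys) + esym R 2 (xs ++ ys)
      ≈⟨ +-cong (*-congˡ (trans (e₁≈p₁ (xs ++ ys)) (foldMap-++ (λ x → x) xs ys))) (e₂-++ xs ys) ⟩
    x * (p₁ xs + p₁ ys) + (esym R 2 xs + p₁ xs * p₁ ys + esym R 2 ys)
      ≈⟨ solve 5 (λ x a₁ b₁ a₂ b₂ → (x :* (a₁ :+ b₁) :+ (a₂ :+ a₁ :* b₁ :+ b₂)) :=
                                    ((x :* a₁ :+ a₂) :+ (x :+ a₁) :* b₁ :+ b₂))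
           refl x (p₁ xs) (p₁ ys) (esym R 2 xs) (esym R 2 ys) ⟩
    (x * p₁ xs + esym R 2 xs) + (x + p₁ xs) * p₁ ys + esym R 2 ys
      ≈⟨ +-congʳ (+-cong (+-congʳ (*-congˡ (e₁≈p₁ xs))) refl) ⟨
    esym R 2 (x ∷ xs) + p₁ (x ∷ xs) * p₁ ys + esym R 2 ys ∎

  newton₂ : ∀ xs → (1# + 1#) * esym R 2 xs ≈ p₁ xs * p₁ xs - p₂ xs
  newton₂ []       = solve 0 ((con (ℤ.+ 1) :+ con (ℤ.+ 1)) :* con (ℤ.+ 0) := (con (ℤ.+ 0) :* con (ℤ.+ 0) :- con (ℤ.+ 0))) refl
  newton₂ (x ∷ xs) = begin
    (1# + 1#) * (x * esym R 1 xs + esym R 2 xs)     ≈⟨ *-congˡ (+-congʳ (*-congˡ (e₁≈p₁ xs))) ⟩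
    (1# + 1#) * (x * p₁ xs + esym R 2 xs)           ≈⟨ solve 3 (λ x a e → (two :* (x :* a :+ e)) := (two :* x :* a :+ two :* e))
                                                         refl x (p₁ xs) (esym R 2 xs) ⟩
    (1# + 1#) * x * p₁ xs + (1# + 1#) * esym R 2 xs ≈⟨ +-congˡ (newton₂ xs) ⟩
    (1# + 1#) * x * p₁ xs + (p₁ xs * p₁ xs - p₂ xs) ≈⟨ solve 3 (λ x a p → (two :* x :* a :+ (a :* a :- p)) :=
                                                         ((x :+ a) :* (x :+ a) :- (x :* x :+ p)))
                                                         refl x (p₁ xs) (p₂ xs) ⟩
    (x + p₁ xs) * (x + p₁ xs) - (x * x + p₂ xs)     ∎
    where two = con (ℤ.+ 1) :+ con (ℤ.+ 1)

module FieldLemmas {c ℓ} (F : CommutativeRing c ℓ) (isField : IsField F) where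

  open import Data.Product using (_,_)
  open import Relation.Nullary using (¬_)

  open CommutativeRing F
  open IsField isField
  open import Algebra.Properties.Ring ring using (x∙y⁻¹≈ε⇒x≈y; x≈y⇒x∙y⁻¹≈ε; x[y-z]≈xy-xz)
  open IntegerSolver F using (solve; _:=_; _:*_)
  open import Relation.Binary.Reasoning.Setoid setoid

  nonzero-cancel : ∀ {a b} → ¬ a ≈ 0# → a * b ≈ 0# → b ≈ 0#
  nonzero-cancel {a} {b} a≉0 ab≈0 with inverse a a≉0
  ... | a⁻¹ , aa⁻¹≈1 = begin
    b               ≈⟨ *-identityˡ b ⟨
    1# * b          ≈⟨ *-congʳ aa⁻¹≈1 ⟨
    (a * a⁻¹) * b   ≈⟨ solve 3 (λ a a⁻¹ b → (a :* a⁻¹) :* b := a⁻¹ :* (a :* b)) refl a a⁻¹ b ⟩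
    a⁻¹ * (a * b)   ≈⟨ *-congˡ ab≈0 ⟩
    a⁻¹ * 0#        ≈⟨ zeroʳ a⁻¹ ⟩
    0#              ∎

  *-nonzero : ∀ {a b} → ¬ a ≈ 0# → ¬ b ≈ 0# → ¬ a * b ≈ 0#
  *-nonzero a≉0 b≉0 ab≈0 = b≉0 (nonzero-cancel a≉0 ab≈0)

  *-cancelˡ-nonzero : ∀ x {a b} → ¬ x ≈ 0# → x * a ≈ x * b → a ≈ b
  *-cancelˡ-nonzero x {a} {b} x≉0 xa≈xb =
    x∙y⁻¹≈ε⇒x≈y a b (nonzero-cancel x≉0 (trans (x[y-z]≈xy-xz x a b) (x≈y⇒x∙y⁻¹≈ε xa≈xb)))

module FiniteField {c ℓ} (F : CommutativeRing c ℓ) (isField : IsField F)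
  (_≟_ : Decidable (CommutativeRing._≈_ F)) {q} (order : HasOrder F q) where

  open import Algebra.Bundles using (CommutativeRing; Semiring)
  open import Data.Nat as ℕ using (zero; suc; _<_)
  import Data.Nat.Properties as ℕ
  import Data.Fin as Fin
  open import Data.List using (List; tabulate; length)
  open import Data.List.Properties using (length-tabulate)
  import Data.List.Relation.Unary.All.Properties as All
  import Data.List.Relation.Unary.AllPairs.Properties as AllPairs
  open import Data.List.Relation.Unary.All using (All)
  open import Data.List.Relation.Unary.AllPairs using (AllPairs)
  open import Data.Product using (proj₁; proj₂)
  open import Data.Bool using (if_then_else_)
  open import Function using (_∘_)
  open import Relation.Nullary using (¬_; yes; no; does; contradiction)
  open import Relation.Binary.PropositionalEquality as ≡ using (_≡_; _≢_)

  open CommutativeRing F hiding (zero)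
  open IsField isField
  open import Algebra.Definitions.RawSemiring (Semiring.rawSemiring semiring) using (_^_)
  open import Algebra.Properties.Ring ring using (+-cancelʳ; -0#≈0#; -‿involutive)
  open IntegerSolver F using (solve; _:=_; _:+_; :-_)
  import Relation.Binary.Reasoning.Setoid as SetoidReasoning
  private module ≈-Reasoning = SetoidReasoning setoid
  open FiniteSetoid setoid _≟_ order
  open Polynomials F
  open FieldLemmas F isField
  private
    module Additive = MonoidFolds +-commutativeMonoid
    module Multiplicative = MonoidFolds *-commutativeMonoid

  q×x≈0 : ∀ x → q Additive.× x ≈ 0#
  q×x≈0 x = +-cancelʳ (sum element) _ _ (begin
    q × x + sum element                 ≈⟨ +-congʳ (Additive.sum-replicate q) ⟨
    sum {q} (λ _ → x) + sum element     ≈⟨ Additive.∑-distrib-+ (λ _ → x) element ⟨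
    sum (λ i → x + element i)           ≈⟨ sum-bijection +-commutativeMonoid (x +_) (- x +_) +-congˡ +-congˡ
                                             (λ y → solve 2 (λ x y → x :+ (:- x :+ y) := y) refl x y)
                                             (λ y → solve 2 (λ x y → :- x :+ (x :+ y) := y) refl x y)
                                             (λ y → y) (λ y≈z → y≈z) ⟩
    sum element                         ≈⟨ +-identityˡ _ ⟨
    0# + sum element                    ∎)
    where
    open Additive using (sum; _×_)
    open ≈-Reasoning

  odd-order⇒1+1≉0 : ∀ k → q ≡ suc (k ℕ.* 2) → ¬ 1# + 1# ≈ 0#
  odd-order⇒1+1≉0 k q≡ 1+1≈0 = 1≉0 (trans (sym (odd×1 k)) (trans (reflexive (≡.cong (_× 1#) (≡.sym q≡))) (q×x≈0 1#)))
    where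
    open Additive using (_×_)
    odd×1 : ∀ k → suc (k ℕ.* 2) × 1# ≈ 1#
    odd×1 zero    = +-identityʳ 1#
    odd×1 (suc k) = trans (sym (+-assoc _ _ _)) (trans (+-congʳ 1+1≈0) (trans (+-identityˡ _) (odd×1 k)))

  private
    open Multiplicative using () renaming (sum to Π)

    orOne : Carrier → Carrier
    orOne u = if does (u ≟ 0#) then 1# else u

    orOne-cong : ∀ {u v} → u ≈ v → orOne u ≈ orOne v
    orOne-cong {u} {v} u≈v with u ≟ 0# | v ≟ 0#
    ... | yes _   | yes _   = refl
    ... | yes u≈0 | no v≉0  = contradiction (trans (sym u≈v) u≈0) v≉0
    ... | no u≉0  | yes v≈0 = contradiction (trans u≈v v≈0) u≉0
    ... | no _    | no _    = u≈v

    orOne-nonzero : ∀ u → ¬ orOne u ≈ 0#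
    orOne-nonzero u with u ≟ 0#
    ... | yes _  = 1≉0
    ... | no u≉0 = u≉0

    product-nonzero : ∀ {n} (f : Fin n → Carrier) → (∀ i → ¬ f i ≈ 0#) → ¬ Π f ≈ 0#
    product-nonzero {zero}  f f≉0 = 1≉0
    product-nonzero {suc n} f f≉0 = *-nonzero (f≉0 Fin.zero) (product-nonzero (f ∘ Fin.suc) (f≉0 ∘ Fin.suc))

    zero^n : ∀ {n} → Fin n → ∀ x → x ≈ 0# → x ^ n ≈ x
    zero^n {suc n} _ x x≈0 = trans (*-congʳ x≈0) (trans (zeroˡ _) (sym x≈0))

    x-except-at-0 : Carrier → Fin q → Carrier
    x-except-at-0 x i = if does (element i ≟ 0#) then 1# else x

    -- Multiplication by x permutes F, and orOne keeps the product over F away from 0.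
    ∏x-except-at-0≈1 : ∀ {x} → ¬ x ≈ 0# → Π (x-except-at-0 x) ≈ 1#
    ∏x-except-at-0≈1 {x} x≉0 = *-cancelˡ-nonzero Z (product-nonzero (orOne ∘ element) (orOne-nonzero ∘ element)) (begin
      Z * Π (x-except-at-0 x)                        ≈⟨ *-comm _ _ ⟩
      Π (x-except-at-0 x) * Z                        ≈⟨ Multiplicative.∑-distrib-+ (x-except-at-0 x) (orOne ∘ element) ⟨
      Π (λ i → x-except-at-0 x i * orOne (element i)) ≈⟨ Multiplicative.sum-cong-≋ (λ i → orOne-* (element i)) ⟨
      Π (λ i → orOne (x * element i))                ≈⟨ sum-bijection *-commutativeMonoid (x *_) (x⁻¹ *_) *-congˡ *-congˡ
                                                           (λ y → trans (sym (*-assoc x x⁻¹ y)) (trans (*-congʳ xx⁻¹≈1) (*-identityˡ y)))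
                                                           (λ y → trans (sym (*-assoc x⁻¹ x y)) (trans (*-congʳ (trans (*-comm x⁻¹ x) xx⁻¹≈1)) (*-identityˡ y)))
                                                           orOne orOne-cong ⟩
      Z                                              ≈⟨ *-identityʳ Z ⟨
      Z * 1#                                         ∎)
      where
      open ≈-Reasoning
      x⁻¹ = proj₁ (inverse x x≉0)
      xx⁻¹≈1 = proj₂ (inverse x x≉0)
      Z = Π (orOne ∘ element)
      orOne-* : ∀ u → orOne (x * u) ≈ (if does (u ≟ 0#) then 1# else x) * orOne u
      orOne-* u with u ≟ 0# | (x * u) ≟ 0#
      ... | yes _   | yes _    = sym (*-identityˡ 1#)
      ... | yes u≈0 | no xu≉0  = contradiction (trans (*-congˡ u≈0) (zeroʳ x)) xu≉0
      ... | no u≉0  | yes xu≈0 = contradiction xu≈0 (*-nonzero x≉0 u≉0)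
      ... | no _    | no _     = refl

  x^q≈x : ∀ x → x ^ q ≈ x
  x^q≈x x with x ≟ 0#
  ... | yes x≈0 = zero^n (index 0#) x x≈0
  ... | no  x≉0 = begin
    x ^ q                                  ≈⟨ *-identityˡ _ ⟨
    1# * x ^ q                             ≈⟨ *-congʳ at-0 ⟨
    x-except-at-0 x (index 0#) * x ^ q     ≈⟨ Multiplicative.sum-allBut (x-except-at-0 x) (index 0#) x elsewhere ⟨
    Π (x-except-at-0 x) * x                ≈⟨ *-congʳ (∏x-except-at-0≈1 x≉0) ⟩
    1# * x                                 ≈⟨ *-identityˡ x ⟩
    x                                      ∎
    where
    open ≈-Reasoning
    at-0 : x-except-at-0 x (index 0#) ≈ 1#
    at-0 with element (index 0#) ≟ 0#
    ... | yes _  = refl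
    ... | no e≉0 = contradiction (element-index 0#) e≉0
    elsewhere : ∀ i → i ≢ index 0# → x-except-at-0 x i ≈ x
    elsewhere i i≢ with element i ≟ 0#
    ... | yes ei≈0 = contradiction (≡.sym (≈element⇒index≡ (sym ei≈0))) i≢
    ... | no _     = refl

  elements : List Carrier
  elements = tabulate element

  X^q-X : Poly F
  X^q-X = _-P_ F (Xpow F q) (Xpow F 1)

  module _ (1<q : 1 < q) where

    private
      length-elements : length elements ≡ q
      length-elements = length-tabulate element

      coeff-X^q-X : ∀ m → coeff F X^q-X m ≈ coeff F (Xpow F q) m - coeff F (Xpow F 1) m
      coeff-X^q-X = coeff-- (Xpow F q) (Xpow F 1)

      degree : Degree≤ X^q-X q
      degree m q<m = begin
        coeff F X^q-X m                            ≈⟨ coeff-X^q-X m ⟩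
        coeff F (Xpow F q) m - coeff F (Xpow F 1) m ≈⟨ +-cong (reflexive (coeff-X^-≢ q m (ℕ.<⇒≢ q<m ∘ ≡.sym)))
                                                             (-‿cong (reflexive (coeff-X^-≢ 1 m (ℕ.<⇒≢ (ℕ.<-trans 1<q q<m) ∘ ≡.sym)))) ⟩
        0# - 0#                                    ≈⟨ -‿inverseʳ 0# ⟩
        0#                                         ∎
        where open ≈-Reasoning

      monic : coeff F X^q-X q ≈ 1#
      monic = begin
        coeff F X^q-X q                            ≈⟨ coeff-X^q-X q ⟩
        coeff F (Xpow F q) q - coeff F (Xpow F 1) q ≈⟨ +-cong (reflexive (coeff-X^-≡ q)) (-‿cong (reflexive (coeff-X^-≢ 1 q (ℕ.<⇒≢ 1<q ∘ ≡.sym)))) ⟩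
        1# - 0#                                    ≈⟨ +-congˡ -0#≈0# ⟩
        1# + 0#                                    ≈⟨ +-identityʳ 1# ⟩
        1#                                         ∎
        where open ≈-Reasoning

    X^q-X≈∏[X-a] : X^q-X ≈ₚ ∏ₚ (λ a → X+ (- a)) elements
    X^q-X≈∏[X-a] = monic-roots-factor nonzero-cancel elements X^q-X
      (≡.subst (Degree≤ X^q-X) (≡.sym length-elements) degree)
      (≡.subst (λ n → coeff F X^q-X n ≈ 1#) (≡.sym length-elements) monic) roots distinct
      where
      open ≈-Reasoning
      roots : All (λ a → eval X^q-X a ≈ 0#) elements
      roots = All.tabulate⁺ λ i → begin
        eval X^q-X (element i)                    ≈⟨ eval-- (Xpow F q) (Xpow F 1) (element i) ⟩
        eval (Xpow F q) (element i) - eval (Xpow F 1) (element i) ≈⟨ +-cong (trans (eval-X^ q _) (x^q≈x _)) (-‿cong (trans (eval-X^ 1 _) (*-identityʳ _))) ⟩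
        element i - element i                     ≈⟨ -‿inverseʳ _ ⟩
        0#                                        ∎
      distinct : AllPairs (λ a b → ¬ a ≈ b) elements
      distinct = AllPairs.tabulate⁺ λ i≢j ei≈ej → i≢j (element-injective ei≈ej)

    ∏[X+a]≈X^q-X : ∏ₚ X+_ elements ≈ₚ X^q-X
    ∏[X+a]≈X^q-X = begin
      ∏ₚ X+_ elements                      ≡⟨ Poly.foldMap-tabulate X+_ element ⟩
      Poly.sum (λ i → X+ element i)        ≈⟨ sum-bijection *ₚ-commutativeMonoid -_ -_ -‿cong -‿cong
                                               -‿involutive -‿involutive X+_ X+-cong ⟨
      Poly.sum (λ i → X+ (- element i))    ≡⟨ Poly.foldMap-tabulate (λ a → X+ (- a)) element ⟨
      ∏ₚ (λ a → X+ (- a)) elements         ≈⟨ X^q-X≈∏[X-a] ⟨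
      X^q-X                                ∎
      where
      module Poly = MonoidFolds *ₚ-commutativeMonoid
      open ≈ₚ-Reasoning

module PlaneGeometry {c ℓ} (F : CommutativeRing c ℓ) (isField : IsField F)
  (_≟_ : Decidable (CommutativeRing._≈_ F)) where

  import Data.Integer as ℤ
  open import Level using (_⊔_)
  open import Data.Product using (Σ; _×_; _,_)
  open import Relation.Nullary using (¬_; yes; no; contradiction)

  open CommutativeRing F
  open IsField isField
  open IntegerSolver F using (solve; _:=_; _:+_; _:*_; :-_; _:-_; con)
  open FieldLemmas F isField using (nonzero-cancel)
  open import Algebra.Properties.Ring ring using (x∙y⁻¹≈ε⇒x≈y)
  open import Relation.Binary.Reasoning.Setoid setoid

  form : Carrier → Carrier → Carrier → Carrier → Carrier → Carrier → Carrier
  form m₀ m₁ m₂ d₀ d₁ d₂ = m₀ * d₀ + m₁ * d₁ + m₂ * d₂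

  form-- : ∀ m₀ m₁ m₂ u₀ u₁ u₂ v₀ v₁ v₂ →
           form m₀ m₁ m₂ (u₀ - v₀) (u₁ - v₁) (u₂ - v₂) ≈ form m₀ m₁ m₂ u₀ u₁ u₂ - form m₀ m₁ m₂ v₀ v₁ v₂
  form-- = solve 9 (λ m₀ m₁ m₂ u₀ u₁ u₂ v₀ v₁ v₂ →
    m₀ :* (u₀ :- v₀) :+ m₁ :* (u₁ :- v₁) :+ m₂ :* (u₂ :- v₂) :=
    (m₀ :* u₀ :+ m₁ :* u₁ :+ m₂ :* u₂) :- (m₀ :* v₀ :+ m₁ :* v₁ :+ m₂ :* v₂)) refl

  Proportional : Carrier → Carrier → Carrier → Carrier → Carrier → Carrier → Set (c ⊔ ℓ)
  Proportional d₀ d₁ d₂ x₀ x₁ x₂ = Σ Carrier λ λ′ → d₀ ≈ λ′ * x₀ × d₁ ≈ λ′ * x₁ × d₂ ≈ λ′ * x₂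

  -- The coordinates play three roles: k where x is nonzero, a where n is nonzero, and b.  In the plane
  -- n·d = 0, the form d ↦ x_k d_b - x_b d_k cuts out exactly the multiples of x.
  private
    proportional-in-roles : ∀ {nk na nb xk xa xb dk da db} → ¬ xk ≈ 0# → ¬ na ≈ 0# →
      form nk na nb xk xa xb ≈ 0# → form nk na nb dk da db ≈ 0# → form (- xb) 0# xk dk da db ≈ 0# →
      Proportional dk da db xk xa xb
    proportional-in-roles {nk} {na} {nb} {xk} {xa} {xb} {dk} {da} {db} xk≉0 na≉0 nx≈0 nd≈0 md≈0
      with inverse xk xk≉0
    ... | xk⁻¹ , xkxk⁻¹≈1 =
      dk * xk⁻¹ , scaled dk xk (-‿inverseʳ (dk * xk)) , scaled da xa α≈0 , scaled db xb β≈0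
      where
      scaled : ∀ u v → u * xk - dk * v ≈ 0# → u ≈ (dk * xk⁻¹) * v
      scaled u v uxk-dkv≈0 = begin
        u                    ≈⟨ *-identityʳ u ⟨
        u * 1#               ≈⟨ *-congˡ xkxk⁻¹≈1 ⟨
        u * (xk * xk⁻¹)      ≈⟨ *-assoc u xk xk⁻¹ ⟨
        (u * xk) * xk⁻¹      ≈⟨ *-congʳ (x∙y⁻¹≈ε⇒x≈y _ _ uxk-dkv≈0) ⟩
        (dk * v) * xk⁻¹      ≈⟨ solve 3 (λ dk v i → (dk :* v) :* i := (dk :* i) :* v) refl dk v xk⁻¹ ⟩
        (dk * xk⁻¹) * v      ∎
      β≈0 : db * xk - dk * xb ≈ 0#
      β≈0 = trans (solve 5 (λ db xk dk xb da → db :* xk :- dk :* xb := (:- xb) :* dk :+ con (ℤ.+ 0) :* da :+ xk :* db)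
                     refl db xk dk xb da) md≈0
      α≈0 : da * xk - dk * xa ≈ 0#
      α≈0 = nonzero-cancel na≉0 (begin
        na * (da * xk - dk * xa)
          ≈⟨ solve 9 (λ nk na nb xk xa xb dk da db →
               na :* (da :* xk :- dk :* xa) :=
               xk :* (nk :* dk :+ na :* da :+ nb :* db) :- dk :* (nk :* xk :+ na :* xa :+ nb :* xb)
                 :- nb :* (db :* xk :- dk :* xb))
               refl nk na nb xk xa xb dk da db ⟩
        xk * form nk na nb dk da db - dk * form nk na nb xk xa xb - nb * (db * xk - dk * xb)
          ≈⟨ +-cong (+-cong (*-congˡ nd≈0) (-‿cong (*-congˡ nx≈0))) (-‿cong (*-congˡ β≈0)) ⟩
        xk * 0# - dk * 0# - nb * 0#
          ≈⟨ solve 3 (λ xk dk nb → xk :* con (ℤ.+ 0) :- dk :* con (ℤ.+ 0) :- nb :* con (ℤ.+ 0) := con (ℤ.+ 0)) refl xk dk nb ⟩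
        0# ∎)

    reorder-021 : ∀ {a₀ a₁ a₂ b₀ b₁ b₂} → form a₀ a₁ a₂ b₀ b₁ b₂ ≈ 0# → form a₀ a₂ a₁ b₀ b₂ b₁ ≈ 0#
    reorder-021 {a₀} {a₁} {a₂} {b₀} {b₁} {b₂} = trans (solve 6 (λ a₀ a₁ a₂ b₀ b₁ b₂ →
      a₀ :* b₀ :+ a₂ :* b₂ :+ a₁ :* b₁ := a₀ :* b₀ :+ a₁ :* b₁ :+ a₂ :* b₂) refl a₀ a₁ a₂ b₀ b₁ b₂)

    reorder-102 : ∀ {a₀ a₁ a₂ b₀ b₁ b₂} → form a₀ a₁ a₂ b₀ b₁ b₂ ≈ 0# → form a₁ a₀ a₂ b₁ b₀ b₂ ≈ 0#
    reorder-102 {a₀} {a₁} {a₂} {b₀} {b₁} {b₂} = trans (solve 6 (λ a₀ a₁ a₂ b₀ b₁ b₂ →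
      a₁ :* b₁ :+ a₀ :* b₀ :+ a₂ :* b₂ := a₀ :* b₀ :+ a₁ :* b₁ :+ a₂ :* b₂) refl a₀ a₁ a₂ b₀ b₁ b₂)

    reorder-120 : ∀ {a₀ a₁ a₂ b₀ b₁ b₂} → form a₀ a₁ a₂ b₀ b₁ b₂ ≈ 0# → form a₁ a₂ a₀ b₁ b₂ b₀ ≈ 0#
    reorder-120 {a₀} {a₁} {a₂} {b₀} {b₁} {b₂} = trans (solve 6 (λ a₀ a₁ a₂ b₀ b₁ b₂ →
      a₁ :* b₁ :+ a₂ :* b₂ :+ a₀ :* b₀ := a₀ :* b₀ :+ a₁ :* b₁ :+ a₂ :* b₂) refl a₀ a₁ a₂ b₀ b₁ b₂)

    reorder-201 : ∀ {a₀ a₁ a₂ b₀ b₁ b₂} → form a₀ a₁ a₂ b₀ b₁ b₂ ≈ 0# → form a₂ a₀ a₁ b₂ b₀ b₁ ≈ 0#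
    reorder-201 {a₀} {a₁} {a₂} {b₀} {b₁} {b₂} = trans (solve 6 (λ a₀ a₁ a₂ b₀ b₁ b₂ →
      a₂ :* b₂ :+ a₀ :* b₀ :+ a₁ :* b₁ := a₀ :* b₀ :+ a₁ :* b₁ :+ a₂ :* b₂) refl a₀ a₁ a₂ b₀ b₁ b₂)

    reorder-210 : ∀ {a₀ a₁ a₂ b₀ b₁ b₂} → form a₀ a₁ a₂ b₀ b₁ b₂ ≈ 0# → form a₂ a₁ a₀ b₂ b₁ b₀ ≈ 0#
    reorder-210 {a₀} {a₁} {a₂} {b₀} {b₁} {b₂} = trans (solve 6 (λ a₀ a₁ a₂ b₀ b₁ b₂ →
      a₂ :* b₂ :+ a₁ :* b₁ :+ a₀ :* b₀ := a₀ :* b₀ :+ a₁ :* b₁ :+ a₂ :* b₂) refl a₀ a₁ a₂ b₀ b₁ b₂)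

    lone-term : ∀ {n₀ n₁ n₂ u₀ u₁ u₂} → ¬ u₀ ≈ 0# → n₁ ≈ 0# → n₂ ≈ 0# → form n₀ n₁ n₂ u₀ u₁ u₂ ≈ 0# → n₀ ≈ 0#
    lone-term {n₀} {n₁} {n₂} {u₀} {u₁} {u₂} u₀≉0 n₁≈0 n₂≈0 nu≈0 = nonzero-cancel u₀≉0 (begin
      u₀ * n₀                           ≈⟨ *-comm u₀ n₀ ⟩
      n₀ * u₀                           ≈⟨ +-identityʳ _ ⟨
      n₀ * u₀ + 0#                      ≈⟨ +-congˡ (trans (*-congʳ n₁≈0) (zeroˡ u₁)) ⟨
      n₀ * u₀ + n₁ * u₁                 ≈⟨ +-identityʳ _ ⟨
      n₀ * u₀ + n₁ * u₁ + 0#            ≈⟨ +-congˡ (trans (*-congʳ n₂≈0) (zeroˡ u₂)) ⟨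
      form n₀ n₁ n₂ u₀ u₁ u₂            ≈⟨ nu≈0 ⟩
      0#                                ∎)

  record SeparatingForm (y z w x₀ x₁ x₂ : Carrier) : Set (c ⊔ ℓ) where
    field
      m₀ m₁ m₂    : Carrier
      kernel⊆span : ∀ {d₀ d₁ d₂} → form y z w d₀ d₁ d₂ ≈ 0# → form m₀ m₁ m₂ d₀ d₁ d₂ ≈ 0# →
                    Proportional d₀ d₁ d₂ x₀ x₁ x₂

  separatingForm : ∀ {y z w x₀ x₁ x₂} → ¬ (y ≈ 0# × z ≈ 0# × w ≈ 0#) → ¬ (x₀ ≈ 0# × x₁ ≈ 0# × x₂ ≈ 0#) →
                   form y z w x₀ x₁ x₂ ≈ 0# → SeparatingForm y z w x₀ x₁ x₂
  separatingForm {y} {z} {w} {x₀} {x₁} {x₂} n≉0 x≉0 nx≈0 with x₀ ≟ 0# | x₁ ≟ 0# | x₂ ≟ 0#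
  ... | no x₀≉0 | _ | _ with z ≟ 0# | w ≟ 0#
  ...   | no z≉0  | _      = record { m₀ = - x₂ ; m₁ = 0# ; m₂ = x₀ ; kernel⊆span = λ nd md →
                               proportional-in-roles x₀≉0 z≉0 nx≈0 nd md }
  ...   | yes z≈0 | no w≉0 = record { m₀ = - x₁ ; m₁ = x₀ ; m₂ = 0# ; kernel⊆span = λ nd md →
                               let λ′ , e₀ , e₂ , e₁ = proportional-in-roles x₀≉0 w≉0 (reorder-021 nx≈0) (reorder-021 nd) (reorder-021 md)
                               in λ′ , e₀ , e₁ , e₂ }
  ...   | yes z≈0 | yes w≈0 = contradiction (lone-term x₀≉0 z≈0 w≈0 nx≈0 , z≈0 , w≈0) n≉0
  separatingForm {y} {z} {w} {x₀} {x₁} {x₂} n≉0 x≉0 nx≈0 | yes x₀≈0 | no x₁≉0 | _ with y ≟ 0# | w ≟ 0#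
  ...   | no y≉0  | _      = record { m₀ = 0# ; m₁ = - x₂ ; m₂ = x₁ ; kernel⊆span = λ nd md →
                               let λ′ , e₁ , e₀ , e₂ = proportional-in-roles x₁≉0 y≉0 (reorder-102 nx≈0) (reorder-102 nd) (reorder-102 md)
                               in λ′ , e₀ , e₁ , e₂ }
  ...   | yes y≈0 | no w≉0 = record { m₀ = x₁ ; m₁ = - x₀ ; m₂ = 0# ; kernel⊆span = λ nd md →
                               let λ′ , e₁ , e₂ , e₀ = proportional-in-roles x₁≉0 w≉0 (reorder-120 nx≈0) (reorder-120 nd) (reorder-120 md)
                               in λ′ , e₀ , e₁ , e₂ }
  ...   | yes y≈0 | yes w≈0 = contradiction (y≈0 , lone-term x₁≉0 y≈0 w≈0 (reorder-102 nx≈0) , w≈0) n≉0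
  separatingForm {y} {z} {w} {x₀} {x₁} {x₂} n≉0 x≉0 nx≈0 | yes x₀≈0 | yes x₁≈0 | no x₂≉0 with y ≟ 0# | z ≟ 0#
  ...   | no y≉0  | _      = record { m₀ = 0# ; m₁ = x₂ ; m₂ = - x₁ ; kernel⊆span = λ nd md →
                               let λ′ , e₂ , e₀ , e₁ = proportional-in-roles x₂≉0 y≉0 (reorder-201 nx≈0) (reorder-201 nd) (reorder-201 md)
                               in λ′ , e₀ , e₁ , e₂ }
  ...   | yes y≈0 | no z≉0 = record { m₀ = x₂ ; m₁ = 0# ; m₂ = - x₀ ; kernel⊆span = λ nd md →
                               let λ′ , e₂ , e₁ , e₀ = proportional-in-roles x₂≉0 z≉0 (reorder-210 nx≈0) (reorder-210 nd) (reorder-210 md)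
                               in λ′ , e₀ , e₁ , e₂ }
  ...   | yes y≈0 | yes z≈0 = contradiction (y≈0 , z≈0 , lone-term x₂≉0 y≈0 z≈0 (reorder-201 nx≈0)) n≉0
  separatingForm n≉0 x≉0 nx≈0 | yes x₀≈0 | yes x₁≈0 | yes x₂≈0 = contradiction (x₀≈0 , x₁≈0 , x₂≈0) x≉0

  evalQ-scale : ∀ Q λ′ {x₀ x₁ x₂ d₀ d₁ d₂} → d₀ ≈ λ′ * x₀ → d₁ ≈ λ′ * x₁ → d₂ ≈ λ′ * x₂ →
                evalQ F Q d₀ d₁ d₂ ≈ (λ′ * λ′) * evalQ F Q x₀ x₁ x₂
  evalQ-scale (conic A B C D E F′) λ′ {x₀} {x₁} {x₂} e₀ e₁ e₂ = trans
    (+-cong (+-cong (+-cong (+-cong (+-cong (*-congˡ (*-cong e₀ e₀)) (*-congˡ (*-cong e₁ e₁))) (*-congˡ (*-cong e₂ e₂)))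
      (*-congˡ (*-cong e₀ e₁))) (*-congˡ (*-cong e₀ e₂))) (*-congˡ (*-cong e₁ e₂)))
    (solve 10 (λ A B C D E F′ l x₀ x₁ x₂ →
       A :* ((l :* x₀) :* (l :* x₀)) :+ B :* ((l :* x₁) :* (l :* x₁)) :+ C :* ((l :* x₂) :* (l :* x₂))
         :+ D :* ((l :* x₀) :* (l :* x₁)) :+ E :* ((l :* x₀) :* (l :* x₂)) :+ F′ :* ((l :* x₁) :* (l :* x₂))
       := (l :* l) :* (A :* (x₀ :* x₀) :+ B :* (x₁ :* x₁) :+ C :* (x₂ :* x₂)
         :+ D :* (x₀ :* x₁) :+ E :* (x₀ :* x₂) :+ F′ :* (x₁ :* x₂)))
       refl A B C D E F′ λ′ x₀ x₁ x₂)

module PrimePowers where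

  open import Data.Nat as ℕ using (ℕ; zero; suc; _+_; _*_; _^_; _<_; _≥_; s≤s)
  import Data.Nat.Properties as ℕ
  open import Data.Nat.DivMod using (_%_; _/_; m≡m%n+[m/n]*n; m%n<n)
  open import Data.Nat.Divisibility using (m%n≡0⇒n∣m)
  open import Data.Nat.Primality using (Prime; prime⇒irreducible; prime⇒nonZero; prime⇒nonTrivial)
  open import Data.Nat.Base using (nonTrivial⇒n>1)
  open import Data.Product using (∃; _,_)
  open import Data.Sum using (inj₁; inj₂)
  open import Relation.Nullary using (¬_; contradiction)
  open import Relation.Binary.PropositionalEquality as ≡ using (_≡_)
  open import Data.Nat.Tactic.RingSolver using (solve-∀)

  Odd : ℕ → Set
  Odd n = ∃ λ k → n ≡ suc (k * 2)

  odd-* : ∀ {m n} → Odd m → Odd n → Odd (m * n)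
  odd-* (a , ≡.refl) (b , ≡.refl) = a + b + a * b * 2 , lemma a b
    where
    lemma : ∀ a b → suc (a * 2) * suc (b * 2) ≡ suc ((a + b + a * b * 2) * 2)
    lemma = solve-∀

  odd-^ : ∀ {p} h → Odd p → Odd (p ^ h)
  odd-^ zero    odd-p = 0 , ≡.refl
  odd-^ (suc h) odd-p = odd-* odd-p (odd-^ h odd-p)

  prime≢2⇒odd : ∀ {p} → Prime p → ¬ p ≡ 2 → Odd p
  prime≢2⇒odd {p} prime-p p≢2 with p % 2 in p%2≡r | m%n<n p 2
  ... | zero | _ with prime⇒irreducible prime-p (m%n≡0⇒n∣m p 2 p%2≡r)
  ...   | inj₁ ()
  ...   | inj₂ 2≡p = contradiction (≡.sym 2≡p) p≢2
  prime≢2⇒odd {p} prime-p p≢2 | suc zero | _ = p / 2 , ≡.trans (m≡m%n+[m/n]*n p 2) (≡.cong (_+ (p / 2) * 2) p%2≡r)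
  prime≢2⇒odd {p} prime-p p≢2 | suc (suc _) | s≤s (s≤s ())

  1<prime^ : ∀ {p} h → Prime p → h ≥ 1 → 1 < p ^ h
  1<prime^ {p} h prime-p h≥1 = ℕ.<-≤-trans 1<p (ℕ.≤-trans (ℕ.≤-reflexive (≡.sym (ℕ.*-identityʳ p))) (ℕ.^-monoʳ-≤ p h≥1))
    where
    instance _ = prime⇒nonZero prime-p
    1<p : 1 < p
    1<p = nonTrivial⇒n>1 p {{prime⇒nonTrivial prime-p}}

-- Opened only here: Data.Nat._^_ and Data.Product._×_ would clash with the ring power and the
-- monoid multiple used above.
open import Level using (Level)
open import Data.Nat using (ℕ; _^_; _∸_; _≥_)
open import Data.Nat.Primality using (Prime)
open import Data.Fin using (Fin)
open import Data.List using (List; []; _∷_; map; allFin)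
open import Data.Product using (_×_)
open import Relation.Nullary using (¬_)
open import Relation.Binary using (Decidable)
open import Relation.Binary.PropositionalEquality using (_≡_)
open import Algebra.Bundles using (CommutativeRing)
open import Data.Product using (_,_)

module Theorem3 {f ℓ} (F : CommutativeRing f ℓ) (isField : IsField F) (_≟_ : Decidable (CommutativeRing._≈_ F))
  {p h} (prime-p : Prime p) (p≢2 : ¬ p ≡ 2) (h≥1 : h ≥ 1) (order : HasOrder F (p ^ h)) where

  import Data.Nat as ℕ
  import Data.Nat.Properties as ℕ
  import Data.Integer as ℤ
  open import Data.List using (_++_; length)
  open import Data.List.Properties using (length-++; length-map; length-tabulate)
  import Data.List.Relation.Unary.AllPairs.Properties as AllPairs
  open import Data.Product using (_,_; proj₁; proj₂)
  open import Function using (_∘_)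
  open import Relation.Binary.PropositionalEquality as ≡ using (_≢_)
  import Relation.Binary.Reasoning.Setoid as SetoidReasoning
  open PrimePowers using (prime≢2⇒odd; odd-^; 1<prime^)

  open CommutativeRing F
  open FiniteSetoid setoid _≟_ order
  open FiniteField F isField _≟_ order
  open FieldLemmas F isField
  open Polynomials F
  open SymmetricFunctions F
  open PlaneGeometry F isField _≟_
  open IntegerSolver F using (solve; _:=_; _:+_; _:*_; _:-_; con)
  open import Algebra.Properties.Ring ring using (x∙y⁻¹≈ε⇒x≈y; x≈y⇒x∙y⁻¹≈ε; +-inverseʳ-unique)

  q N : ℕ
  q = p ^ h
  N = q ^ 2 ∸ 2

  1<q : 1 ℕ.< q
  1<q = 1<prime^ h prime-p h≥1

  N+2≡q*q : N ℕ.+ 2 ≡ q ℕ.* q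
  N+2≡q*q = ≡.trans (ℕ.m∸n+n≡m 2≤q²) (≡.cong (q ℕ.*_) (ℕ.*-identityʳ q))
    where
    2≤q² : 2 ℕ.≤ q ^ 2
    2≤q² = ℕ.*-mono-≤ 1<q (ℕ.≤-trans (ℕ.<⇒≤ 1<q) (ℕ.≤-reflexive (≡.sym (ℕ.*-identityʳ q))))

  private
    module Additive = MonoidFolds +-commutativeMonoid

  1+1≉0 : ¬ 1# + 1# ≈ 0#
  1+1≉0 = let k , q≡ = odd-^ h (prime≢2⇒odd prime-p p≢2) in odd-order⇒1+1≉0 k q≡

  module _ (𝒞 : Conic F) (a b c : Fin N → Carrier)
    (distinct : ∀ i j → ¬ (i ≡ j) → ¬ (a i ≈ a j × b i ≈ b j × c i ≈ c j))
    (no-conic : ∀ i j → ¬ (i ≡ j) → ¬ OnConic F 𝒞 (a i - a j) (b i - b j) (c i - c j))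
    (Σa≈0 : ΣF F N a ≈ 0#) (Σb≈0 : ΣF F N b ≈ 0#) (Σc≈0 : ΣF F N c ≈ 0#)
    {y z w : Carrier} (n≉0 : ¬ (y ≈ 0# × z ≈ 0# × w ≈ 0#))
    {x₀ x₁ x₂ : Carrier} (x-on-𝒞 : OnConic F 𝒞 x₀ x₁ x₂) (x-on-line : form y z w x₀ x₁ x₂ ≈ 0#) where

    t : Fin N → Carrier
    t i = a i * y + b i * z + c i * w

    values : List Carrier
    values = map t (allFin N)

    open SeparatingForm (separatingForm n≉0 (proj₁ x-on-𝒞) x-on-line)

    label : Fin N → Carrier
    label i = form m₀ m₁ m₂ (a i) (b i) (c i)

    t≈form : ∀ i → t i ≈ form y z w (a i) (b i) (c i)
    t≈form i = solve 6 (λ a b c y z w → a :* y :+ b :* z :+ c :* w := y :* a :+ z :* b :+ w :* c) refl (a i) (b i) (c i) y z w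

    -- Two points of U with equal t and equal label differ by a multiple of x, so the line joining
    -- them would meet π∞ in the point x of 𝒞.
    values-separated : ∀ {i j} → i ≢ j → t i ≈ t j → ¬ label i ≈ label j
    values-separated {i} {j} i≢j ti≈tj li≈lj = no-conic i j i≢j (d≉0 , Qd≈0)
      where
      in-plane : form y z w (a i - a j) (b i - b j) (c i - c j) ≈ 0#
      in-plane = trans (form-- y z w (a i) (b i) (c i) (a j) (b j) (c j))
                       (x≈y⇒x∙y⁻¹≈ε (trans (sym (t≈form i)) (trans ti≈tj (t≈form j))))
      in-kernel : form m₀ m₁ m₂ (a i - a j) (b i - b j) (c i - c j) ≈ 0#
      in-kernel = trans (form-- m₀ m₁ m₂ (a i) (b i) (c i) (a j) (b j) (c j)) (x≈y⇒x∙y⁻¹≈ε li≈lj)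
      d∥x = kernel⊆span in-plane in-kernel
      Qd≈0 : evalQ F 𝒞 (a i - a j) (b i - b j) (c i - c j) ≈ 0#
      Qd≈0 = let λ′ , e₀ , e₁ , e₂ = d∥x in
        trans (evalQ-scale 𝒞 λ′ e₀ e₁ e₂) (trans (*-congˡ (proj₂ x-on-𝒞)) (zeroʳ _))
      d≉0 : ¬ (a i - a j ≈ 0# × b i - b j ≈ 0# × c i - c j ≈ 0#)
      d≉0 (Δa≈0 , Δb≈0 , Δc≈0) = distinct i j i≢j (x∙y⁻¹≈ε⇒x≈y _ _ Δa≈0 , x∙y⁻¹≈ε⇒x≈y _ _ Δb≈0 , x∙y⁻¹≈ε⇒x≈y _ _ Δc≈0)

    multiplicity≤q : ∀ k → multiplicity (element k) values ℕ.≤ q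
    multiplicity≤q k = multiplicity-map≤order t label (element k) (allFin N) (AllPairs.tabulate⁺ values-separated)

    deficits : List Carrier
    deficits = complement (λ k → q ∸ multiplicity (element k) values)

    full : List Carrier
    full = values ++ deficits

    multiplicity-full : ∀ k → multiplicity (element k) full ≡ q
    multiplicity-full k = ≡.trans (multiplicity-++ (element k) values deficits)
      (≡.trans (≡.cong (multiplicity (element k) values ℕ.+_) (multiplicity-complement _ k))
               (ℕ.m+[n∸m]≡n (multiplicity≤q k)))

    length-deficits : length deficits ≡ 2
    length-deficits = ℕ.+-cancelˡ-≡ N _ _ (begin
      N ℕ.+ length deficits              ≡⟨ ≡.cong (ℕ._+ length deficits) length-values ⟨
      length values ℕ.+ length deficits  ≡⟨ length-++ values ⟨
      length full                        ≡⟨ length≡∑multiplicity full ⟩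
      ∑ℕ (λ k → multiplicity (element k) full) ≡⟨ ℕ-Folds.sum-cong-≗ multiplicity-full ⟩
      ∑ℕ {q} (λ _ → q)                   ≡⟨ ℕ-Folds.sum-replicate q ⟩
      q ×ℕ q                             ≡⟨ ×ℕ≡* q q ⟩
      q ℕ.* q                            ≡⟨ N+2≡q*q ⟨
      N ℕ.+ 2                            ∎)
      where
      open ≡.≡-Reasoning
      module ℕ-Folds = MonoidFolds ℕ.+-0-commutativeMonoid
      open ℕ-Folds using () renaming (sum to ∑ℕ; _×_ to _×ℕ_)
      length-values : length values ≡ N
      length-values = ≡.trans (length-map t (allFin N)) (length-tabulate (λ i → i))
      ×ℕ≡* : ∀ m n → m ×ℕ n ≡ m ℕ.* n
      ×ℕ≡* ℕ.zero    n = ≡.refl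
      ×ℕ≡* (ℕ.suc m) n = ≡.cong (n ℕ.+_) (×ℕ≡* m n)

    private
      module Poly = MonoidFolds *ₚ-commutativeMonoid

    foldMap-full : (M : CommutativeMonoid f ℓ) (g : Carrier → CommutativeMonoid.Carrier M) →
                   (∀ {u v} → u ≈ v → CommutativeMonoid._≈_ M (g u) (g v)) →
                   CommutativeMonoid._≈_ M (MonoidFolds.foldMap M g full) (MonoidFolds._×_ M q (MonoidFolds.sum M (g ∘ element)))
    foldMap-full M g g-cong = foldMap-uniform M g g-cong full multiplicity-full

    p₁-full : p₁ full ≈ 0#
    p₁-full = trans (foldMap-full +-commutativeMonoid (λ u → u) (λ u≈v → u≈v)) (q×x≈0 _)

    p₂-full : p₂ full ≈ 0#
    p₂-full = trans (foldMap-full +-commutativeMonoid (λ u → u * u) (λ u≈v → *-cong u≈v u≈v)) (q×x≈0 _)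

    e₂-full : esym F 2 full ≈ 0#
    e₂-full = nonzero-cancel 1+1≉0 (begin
      (1# + 1#) * esym F 2 full      ≈⟨ newton₂ full ⟩
      p₁ full * p₁ full - p₂ full    ≈⟨ +-cong (*-cong p₁-full p₁-full) (-‿cong p₂-full) ⟩
      0# * 0# - 0#                   ≈⟨ solve 0 (con (ℤ.+ 0) :* con (ℤ.+ 0) :- con (ℤ.+ 0) := con (ℤ.+ 0)) refl ⟩
      0#                             ∎)
      where open SetoidReasoning setoid

    p₁-values : p₁ values ≈ 0#
    p₁-values = begin
      p₁ values                                   ≡⟨ Additive.foldMap-map (λ u → u) t (allFin N) ⟩
      Additive.foldMap t (allFin N)               ≈⟨ linear (allFin N) ⟩
      ΣF F N a * y + ΣF F N b * z + ΣF F N c * w  ≈⟨ +-cong (+-cong (*-congʳ Σa≈0) (*-congʳ Σb≈0)) (*-congʳ Σc≈0) ⟩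
      0# * y + 0# * z + 0# * w                    ≈⟨ solve 3 (λ y z w → con (ℤ.+ 0) :* y :+ con (ℤ.+ 0) :* z :+ con (ℤ.+ 0) :* w := con (ℤ.+ 0)) refl y z w ⟩
      0#                                          ∎
      where
      open SetoidReasoning setoid
      open Additive using (foldMap)
      linear : ∀ js → foldMap t js ≈ foldMap a js * y + foldMap b js * z + foldMap c js * w
      linear []       = solve 3 (λ y z w → con (ℤ.+ 0) := con (ℤ.+ 0) :* y :+ con (ℤ.+ 0) :* z :+ con (ℤ.+ 0) :* w) refl y z w
      linear (j ∷ js) = trans (+-congˡ (linear js))
        (solve 9 (λ y z w a b c A B C → (a :* y :+ b :* z :+ c :* w) :+ (A :* y :+ B :* z :+ C :* w)
                                       := (a :+ A) :* y :+ (b :+ B) :* z :+ (c :+ C) :* w)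
           refl y z w (a j) (b j) (c j) (foldMap a js) (foldMap b js) (foldMap c js))

    p₁-deficits : p₁ deficits ≈ 0#
    p₁-deficits = begin
      p₁ deficits                 ≈⟨ +-identityˡ _ ⟨
      0# + p₁ deficits            ≈⟨ +-congʳ p₁-values ⟨
      p₁ values + p₁ deficits     ≈⟨ Additive.foldMap-++ (λ u → u) values deficits ⟨
      p₁ full                     ≈⟨ p₁-full ⟩
      0#                          ∎
      where open SetoidReasoning setoid

    σ₂ : Carrier
    σ₂ = esym F 2 values

    e₂-deficits : esym F 2 deficits ≈ - σ₂
    e₂-deficits = +-inverseʳ-unique σ₂ _ (begin
      σ₂ + esym F 2 deficits                                   ≈⟨ +-congʳ (+-identityʳ σ₂) ⟨
      σ₂ + 0# + esym F 2 deficits                              ≈⟨ +-congʳ (+-congˡ (trans (*-congʳ p₁-values) (zeroˡ _))) ⟨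
      σ₂ + p₁ values * p₁ deficits + esym F 2 deficits         ≈⟨ e₂-++ values deficits ⟨
      esym F 2 full                                            ≈⟨ e₂-full ⟩
      0#                                                       ∎)
      where open SetoidReasoning setoid

    X²-σ₂ : Poly F
    X²-σ₂ = _-P_ F (Xpow F 2) (constP F σ₂)

    X²-σ₂≈∏[X+d] : X²-σ₂ ≈ₚ ∏ₚ X+_ deficits
    X²-σ₂≈∏[X+d] = quadratic deficits length-deficits p₁-deficits e₂-deficits
      where
      quadratic : ∀ ds → length ds ≡ 2 → p₁ ds ≈ 0# → esym F 2 ds ≈ - σ₂ → X²-σ₂ ≈ₚ ∏ₚ X+_ ds
      quadratic (d₁ ∷ d₂ ∷ []) _ p₁≈0 e₂≈-σ₂ = ≈ₚ-trans (∷-cong constant (∷-cong linear ≈ₚ-refl)) (≈ₚ-sym (∏ₚ-X+-pair d₁ d₂))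
        where
        constant : 0# + - σ₂ ≈ d₁ * d₂
        constant = trans (+-identityˡ _) (trans (sym e₂≈-σ₂)
          (solve 2 (λ d₁ d₂ → d₁ :* (d₂ :* con (ℤ.+ 1) :+ con (ℤ.+ 0)) :+ (d₂ :* con (ℤ.+ 0) :+ con (ℤ.+ 0)) := d₁ :* d₂) refl d₁ d₂))
        linear : 0# ≈ d₁ + d₂
        linear = sym (trans (+-congˡ (sym (+-identityʳ d₂))) p₁≈0)

    theorem : ΠP F N (λ i → t i ∷ 1# ∷ []) *ₚ X²-σ₂ ≈ₚ _^P_ F X^q-X q
    theorem = begin
      ∏ₚ (X+_ ∘ t) (allFin N) *ₚ X²-σ₂   ≈⟨ *ₚ-cong (≈ₚ-reflexive (≡.sym (Poly.foldMap-map X+_ t (allFin N)))) X²-σ₂≈∏[X+d] ⟩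
      ∏ₚ X+_ values *ₚ ∏ₚ X+_ deficits  ≈⟨ Poly.foldMap-++ X+_ values deficits ⟨
      ∏ₚ X+_ full                       ≈⟨ foldMap-full *ₚ-commutativeMonoid X+_ X+-cong ⟩
      q Poly.× Poly.sum (X+_ ∘ element) ≡⟨ ≡.cong (q Poly.×_) (Poly.foldMap-tabulate X+_ element) ⟨
      q Poly.× ∏ₚ X+_ elements          ≈⟨ Poly.×-congʳ q (∏[X+a]≈X^q-X 1<q) ⟩
      q Poly.× X^q-X                    ≡⟨ ^P≡× X^q-X q ⟨
      _^P_ F X^q-X q                    ∎
      where
      open ≈ₚ-Reasoning
      ^P≡× : ∀ g n → _^P_ F g n ≡ n Poly.× g
      ^P≡× g ℕ.zero    = ≡.refl
      ^P≡× g (ℕ.suc n) = ≡.cong (g *ₚ_) (^P≡× g n)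

mainTheorem3 : ∀ {c ℓ} (F : CommutativeRing c ℓ) → IsField F → Decidable (CommutativeRing._≈_ F) →
  (p h : ℕ) → Prime p → ¬ (p ≡ 2) → h ≥ 1 → HasOrder F (p ^ h) →
  let open CommutativeRing F
      q = p ^ h
      N = q ^ 2 ∸ 2
  in (𝒞 : Conic F) → NonDegenerate F 𝒞 →
  (a b c : Fin N → Carrier) →
  (∀ i j → ¬ (i ≡ j) → ¬ (a i ≈ a j × b i ≈ b j × c i ≈ c j)) →
  (∀ i j → ¬ (i ≡ j) → ¬ OnConic F 𝒞 (a i - a j) (b i - b j) (c i - c j)) →
  ΣF F N a ≈ 0# → ΣF F N b ≈ 0# → ΣF F N c ≈ 0# →
  (y z w : Carrier) → ¬ (y ≈ 0# × z ≈ 0# × w ≈ 0#) →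
  LineMeetsConic F 𝒞 y z w →
  let t : Fin N → Carrier
      t i = a i * y + b i * z + c i * w
      Rpol = ΠP F N (λ i → t i ∷ 1# ∷ [])
      σ₂ = esym F 2 (map t (allFin N))
  in _≈P_ F (_*P_ F Rpol (_-P_ F (Xpow F 2) (constP F σ₂)))
            (_^P_ F (_-P_ F (Xpow F q) (Xpow F 1)) q)
-- Only Q(λx) = λ²Q(x) is used.
mainTheorem3 F isField _≟_ p h prime-p p≢2 h≥1 order 𝒞 _ a b c distinct no-conic Σa≈0 Σb≈0 Σc≈0
             y z w n≉0 (x₀ , x₁ , x₂ , x-on-𝒞 , x-on-line) =
  Polynomials.coeff≈ (Theorem3.theorem F isField _≟_ prime-p p≢2 h≥1 order 𝒞 a b c distinct no-conic
                                        Σa≈0 Σb≈0 Σc≈0 n≉0 x-on-𝒞 x-on-line)
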